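{- Let $S=\{m\}$ be admissible (i.e. $1\le m\le n-1$). Then \[\#\widehat{P}_B(\{m\},n)=4^{n-m-1}\sum_{i=1}^{m}\binom{n}{m-i}\left(3^{m-i}+1\right)4^{i}(-1)^{i+1}-(m\bmod 2)\,\frac{3^{n}+1}{2}.\]
   Context: $B_n$ is the set of signed permutations $\pi=\pi_1\cdots\pi_n$: words with each $\pi_i\in\{ -n,\dots,-1,1,\dots,n\}$ and $\{|\pi_1|,\dots,|\pi_n|\}=\{1,\dots,n\}$. Set $\pi_0=0$. An index $i\in\{1,\dots,n-1\}$ is a peak of $\pi$ if $\pi_{i-1}<\pi_i>\pi_{i+1}$. $\widehat{P}_B(S,n)$ is the set of $\pi\in B_n$ whose peak set (in this sense) equals $S$. $m\bmod 2\in\{0,1\}$ denotes the remainder of $m$ modulo $2$. -}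

module Defs where

open import Data.Nat as ℕ using (ℕ; zero; suc; _∸_)
open import Data.Nat.DivMod using (_%_; _/_)
open import Data.Nat.Combinatorics using (_C_)
open import Data.Integer as ℤ using (ℤ; +_; -_; ∣_∣; _-_)
import Data.Integer.Properties as ℤP
open import Data.List as List using (List; []; _∷_; map; upTo; filter; length; foldr; _++_)
open import Data.List.Relation.Unary.All using (All; all?)
open import Data.List.Relation.Unary.Any using (Any; any?)
open import Data.Vec as Vec using (Vec; toList)
open import Data.Product using (_×_)
open import Relation.Nullary using (Dec; ¬_)
open import Relation.Nullary.Decidable using (_×-dec_; _→-dec_; ¬?)
open import Relation.Binary.PropositionalEquality using (_≡_)

range : ℕ → ℕ → List ℕ
range a k = map (a ℕ.+_) (upTo k)

letters : ℕ → List ℤ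
letters n = map (λ k → - (+ k)) (range 1 n) ++ map +_ (range 1 n)

words : List ℤ → (k : ℕ) → List (Vec ℤ k)
words A zero    = Vec.[] ∷ []
words A (suc k) = List.concatMap (λ a → map (a Vec.∷_) (words A k)) A

IsSignedPerm : (n : ℕ) → Vec ℤ n → Set
IsSignedPerm n π =
  All (λ x → Any (x ≡_) (letters n)) (toList π) ×
  All (λ k → Any (λ x → ∣ x ∣ ≡ k) (toList π)) (range 1 n)

isSignedPerm? : (n : ℕ) (π : Vec ℤ n) → Dec (IsSignedPerm n π)
isSignedPerm? n π =
  all? (λ x → any? (λ y → x ℤ.≟ y) (letters n)) (toList π) ×-dec
  all? (λ k → any? (λ x → ∣ x ∣ ℕ.≟ k) (toList π)) (range 1 n)

-- π_i for i = 0..n, with the convention π_0 = 0 (1-indexed entries)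
entry : List ℤ → ℕ → ℤ
entry xs zero = + 0
entry [] (suc i) = + 0
entry (x ∷ xs) (suc zero) = x
entry (x ∷ xs) (suc (suc i)) = entry xs (suc i)

IsPeak : {n : ℕ} → Vec ℤ n → ℕ → Set
IsPeak π i = (entry (toList π) (i ∸ 1) ℤ.< entry (toList π) i) ×
             (entry (toList π) (suc i) ℤ.< entry (toList π) i)

isPeak? : {n : ℕ} (π : Vec ℤ n) (i : ℕ) → Dec (IsPeak π i)
isPeak? π i = (entry (toList π) (i ∸ 1) ℤ.<? entry (toList π) i) ×-dec
              (entry (toList π) (suc i) ℤ.<? entry (toList π) i)

PeakSetIsSingleton : {n : ℕ} → Vec ℤ n → ℕ → Set
PeakSetIsSingleton {n} π m =
  All (λ i → (IsPeak π i → i ≡ m) × (i ≡ m → IsPeak π i)) (range 1 (n ∸ 1))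

peakSetIsSingleton? : {n : ℕ} (π : Vec ℤ n) (m : ℕ) → Dec (PeakSetIsSingleton π m)
peakSetIsSingleton? π m =
  all? (λ i → (isPeak? π i →-dec (i ℕ.≟ m)) ×-dec ((i ℕ.≟ m) →-dec isPeak? π i)) (range 1 _)

PhatB-singleton : (m n : ℕ) → List (Vec ℤ n)
PhatB-singleton m n =
  filter (λ π → isSignedPerm? n π ×-dec peakSetIsSingleton? π m) (words (letters n) n)

sumℤ : List ℤ → ℤ
sumℤ = foldr ℤ._+_ (+ 0)

module Submission where

-- A signed permutation of [n+1] arises in exactly one way by inserting n+1 or -(n+1) into a
-- signed permutation of [n]. Peaks only depend on the word of ascents and descents of 0 π₁ … πₙ,
-- and inserting a letter larger (smaller) than all others replaces one step of that word by an
-- ascent followed by a descent (a descent followed by an ascent). If a step word is recorded only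
-- through its peak class (no peak, or a single peak at j, together with whether it starts with a
-- descent; or at least two peaks), the number of insertions leading from one class to another
-- depends only on the two classes, so the numbers of signed permutations in each class satisfy
-- linear recurrences in n. Solving them, the signed permutations whose peak set lies in {k, k+1}
-- number C(n,k)(3^k+1)4^(n-k-1); the formula for the peak set {m} is the telescoping alternating
-- sum of these counts, corrected by the (3^n+1)/2 peak-free ones when m is odd.

open import Defs
open import Data.Bool using (Bool; true; false; not; _∧_; _xor_; if_then_else_; T)
import Data.Bool.Properties as Boolₚ
open import Data.Empty using (⊥; ⊥-elim)
open import Data.Unit using (⊤; tt)
open import Data.Nat as ℕ using (ℕ; zero; suc; _+_; _*_; _^_; _∸_; _≤_; _<_; z≤n; s≤s; _≡ᵇ_)
import Data.Nat.Properties as ℕₚ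
open import Data.Nat.DivMod using (_%_; _/_; [m+n]%n≡m%n; m*n/n≡m)
open import Data.Nat.Combinatorics using (_C_; nCk+nC[k+1]≡[n+1]C[k+1]; nCn≡1)
open import Data.Nat.ListAction using (sum)
open import Data.Nat.ListAction.Properties using (sum-++)
import Data.Nat.Tactic.RingSolver as ℕ-Solver
open import Data.Integer as ℤ using (ℤ; +_; -_; ∣_∣; -[1+_]; +<+; -<+; -<-)
import Data.Integer.Properties as ℤₚ
import Data.Integer.Tactic.RingSolver as ℤ-Solver
open import Data.List as List using (List; []; _∷_; map; length; foldr; upTo; applyUpTo; _++_; concatMap; filter)
import Data.List.Properties as Listₚ
open import Data.List.Relation.Unary.All as All using (All; []; _∷_)
open import Data.List.Relation.Unary.Any as Any using (Any; here; there)
open import Data.List.Relation.Unary.AllPairs using ([]; _∷_)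
open import Data.List.Relation.Unary.Linked using (Linked; []; [-]; _∷_)
open import Data.List.Relation.Unary.Unique.Propositional using (Unique)
import Data.List.Relation.Unary.Unique.Propositional.Properties as Uniqueₚ
open import Data.List.Relation.Binary.Permutation.Propositional using (_↭_; prep; swap; ↭-refl; ↭-sym; ↭-trans)
open import Data.List.Relation.Binary.Permutation.Propositional.Properties using (All-resp-↭; Any-resp-↭; ↭-length; filter-↭)
open import Data.List.Relation.Binary.BagAndSetEquality using (∼bag⇒↭)
open import Data.List.Membership.Propositional using (_∈_; _∉_; find)
open import Data.List.Membership.Propositional.Properties
open import Data.List.Membership.Propositional.Properties.WithK using (unique∧set⇒bag)
open import Data.Vec as Vec using (Vec; toList)
import Data.Vec.Properties as Vecₚ
open import Data.Product using (_×_; _,_; proj₁; proj₂; ∃₂; ∃-syntax)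
open import Data.Sum using (inj₁; inj₂)
open import Function using (_∘_; id; _⇔_; mk⇔; Equivalence; case_of_)
import Function.Properties.Equivalence as ⇔
open import Relation.Nullary using (¬_; yes; no; does)
open import Relation.Nullary.Decidable using (_×-dec_; dec-true; dec-false)
open import Relation.Unary using (Decidable)
open import Relation.Binary.PropositionalEquality
open import Algebra.Properties.CommutativeSemigroup ℕₚ.+-commutativeSemigroup using () renaming (interchange to +-interchange)

private variable
  A B : Set
  k n : ℕ

unique-concatMap⁺ : {f : A → List B} {xs : List A} → Unique xs →
  (∀ {x} → x ∈ xs → Unique (f x)) →
  (∀ {x y b} → x ∈ xs → y ∈ xs → b ∈ f x → b ∈ f y → x ≡ y) →
  Unique (concatMap f xs)
unique-concatMap⁺ {xs = []} _ _ _ = []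
unique-concatMap⁺ {f = f} {xs = x ∷ xs} (x∉xs ∷ xs!) f! sharedElement = Uniqueₚ.++⁺
  (f! (here refl))
  (unique-concatMap⁺ xs! (f! ∘ there) (λ x∈ y∈ → sharedElement (there x∈) (there y∈)))
  λ (b∈fx , b∈rest) →
    let y , y∈xs , b∈fy = find (∈-concatMap⁻ f {xs = xs} b∈rest)
    in All.lookup x∉xs y∈xs (sharedElement (here refl) (there y∈xs) b∈fx b∈fy)

sum-map-+ : ∀ (f g : A → ℕ) xs → sum (map (λ x → f x + g x) xs) ≡ sum (map f xs) + sum (map g xs)
sum-map-+ f g []       = refl
sum-map-+ f g (x ∷ xs) = trans (cong (_+_ (f x + g x)) (sum-map-+ f g xs)) (+-interchange (f x) (g x) _ _)

sum-map-* : ∀ a (f : A → ℕ) xs → sum (map (λ x → a * f x) xs) ≡ a * sum (map f xs)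
sum-map-* a f []       = sym (ℕₚ.*-zeroʳ a)
sum-map-* a f (x ∷ xs) = trans (cong (_+_ (a * f x)) (sum-map-* a f xs)) (sym (ℕₚ.*-distribˡ-+ a (f x) _))

sum-map-zero : ∀ {f : A → ℕ} → (∀ x → f x ≡ 0) → ∀ xs → sum (map f xs) ≡ 0
sum-map-zero f≡0 []       = refl
sum-map-zero f≡0 (x ∷ xs) = cong₂ _+_ (f≡0 x) (sum-map-zero f≡0 xs)

sum-map-swap : ∀ (f : A → B → ℕ) xs ys →
  sum (map (λ x → sum (map (f x) ys)) xs) ≡ sum (map (λ y → sum (map (λ x → f x y) xs)) ys)
sum-map-swap f []       ys = sym (sum-map-zero (λ _ → refl) ys)
sum-map-swap f (x ∷ xs) ys = trans (cong (_+_ (sum (map (f x) ys))) (sum-map-swap f xs ys))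
  (sym (sum-map-+ (f x) (λ y → sum (map (λ x → f x y) xs)) ys))

sum-map-concatMap : ∀ (f : B → ℕ) (g : A → List B) xs →
  sum (map f (concatMap g xs)) ≡ sum (map (λ x → sum (map f (g x))) xs)
sum-map-concatMap f g []       = refl
sum-map-concatMap f g (x ∷ xs) = begin
  sum (map f (g x ++ concatMap g xs))           ≡⟨ cong sum (Listₚ.map-++ f (g x) _) ⟩
  sum (map f (g x) ++ map f (concatMap g xs))   ≡⟨ sum-++ (map f (g x)) _ ⟩
  sum (map f (g x)) + sum (map f (concatMap g xs)) ≡⟨ cong (_+_ (sum (map f (g x)))) (sum-map-concatMap f g xs) ⟩
  sum (map f (g x)) + sum (map (λ x → sum (map f (g x))) xs) ∎
  where open ≡-Reasoning

filter-×-dec : ∀ {P Q : A → Set} (P? : Decidable P) (Q? : Decidable Q) xs →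
  filter (λ x → P? x ×-dec Q? x) xs ≡ filter Q? (filter P? xs)
filter-×-dec P? Q? [] = refl
filter-×-dec P? Q? (x ∷ xs) with P? x
... | no _  = filter-×-dec P? Q? xs
... | yes _ with Q? x
...   | yes _ = cong (x ∷_) (filter-×-dec P? Q? xs)
...   | no _  = filter-×-dec P? Q? xs

𝟙 : Bool → ℕ
𝟙 true  = 1
𝟙 false = 0

length-filter≡sum : ∀ {P : A → Set} (P? : Decidable P) xs → length (filter P? xs) ≡ sum (map (𝟙 ∘ does ∘ P?) xs)
length-filter≡sum P? [] = refl
length-filter≡sum P? (x ∷ xs) with P? x
... | yes _ = cong suc (length-filter≡sum P? xs)
... | no _  = length-filter≡sum P? xs

sumℤ-map-* : ∀ (c : ℤ) (f : ℕ → ℤ) xs → sumℤ (map (λ i → c ℤ.* f i) xs) ≡ c ℤ.* sumℤ (map f xs)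
sumℤ-map-* c f []       = sym (ℤₚ.*-zeroʳ c)
sumℤ-map-* c f (x ∷ xs) = trans (cong (ℤ._+_ (c ℤ.* f x)) (sumℤ-map-* c f xs)) (sym (ℤₚ.*-distribˡ-+ c (f x) _))

sumℤ-range-suc : ∀ (f : ℕ → ℤ) k → sumℤ (map f (range 1 (suc k))) ≡ f 1 ℤ.+ sumℤ (map (f ∘ suc) (range 1 k))
sumℤ-range-suc f k = cong (λ xs → f 1 ℤ.+ sumℤ xs) (begin
  map f (map (1 ℕ.+_) (applyUpTo suc k))               ≡⟨ cong (map f) (Listₚ.map-applyUpTo suc (1 ℕ.+_) k) ⟩
  map f (applyUpTo (suc ∘ suc) k)                       ≡⟨ Listₚ.map-applyUpTo (suc ∘ suc) f k ⟩
  applyUpTo (f ∘ suc ∘ suc) k                           ≡⟨ Listₚ.map-applyUpTo suc (f ∘ suc) k ⟨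
  map (f ∘ suc) (applyUpTo suc k)                       ≡⟨ cong (map (f ∘ suc)) (Listₚ.map-applyUpTo id (1 ℕ.+_) k) ⟨
  map (f ∘ suc) (map (1 ℕ.+_) (applyUpTo id k))       ∎)
  where open ≡-Reasoning

sumℤ-range-cong : ∀ {f g : ℕ → ℤ} → (∀ i → f (suc i) ≡ g (suc i)) → ∀ k → sumℤ (map f (range 1 k)) ≡ sumℤ (map g (range 1 k))
sumℤ-range-cong {f} {g} f≗g k = cong sumℤ (begin
  map f (map (1 ℕ.+_) (upTo k))   ≡⟨ Listₚ.map-∘ (upTo k) ⟨
  map (f ∘ suc) (upTo k)          ≡⟨ Listₚ.map-cong f≗g (upTo k) ⟩
  map (g ∘ suc) (upTo k)          ≡⟨ Listₚ.map-∘ (upTo k) ⟩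
  map g (map (1 ℕ.+_) (upTo k))   ∎)
  where open ≡-Reasoning

≡ᵇ-refl : ∀ m → (m ≡ᵇ m) ≡ true
≡ᵇ-refl zero    = refl
≡ᵇ-refl (suc m) = ≡ᵇ-refl m

≢⇒≡ᵇ-false : ∀ {m n} → m ≢ n → (m ≡ᵇ n) ≡ false
≢⇒≡ᵇ-false {m} {n} m≢n with m ≡ᵇ n in eq
... | false = refl
... | true  = ⊥-elim (m≢n (ℕₚ.≡ᵇ⇒≡ m n (subst T (sym eq) tt)))


∈-range⁻ : ∀ {a k j} → j ∈ range a k → a ≤ j × j < a + k
∈-range⁻ {a} {k} j∈ with ∈-map⁻ (ℕ._+_ a) j∈
... | i , i∈ , refl = ℕₚ.m≤m+n a i , ℕₚ.+-monoʳ-< a (∈-upTo⁻ i∈)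

∈-range⁺ : ∀ {a k j} → a ≤ j → j < a + k → j ∈ range a k
∈-range⁺ {a} {k} {j} a≤j j<a+k = subst (_∈ range a k) (ℕₚ.m+[n∸m]≡n a≤j)
  (∈-map⁺ (ℕ._+_ a) (∈-upTo⁺ (ℕₚ.+-cancelˡ-< a _ _ (subst (_< a + k) (sym (ℕₚ.m+[n∸m]≡n a≤j)) j<a+k))))

range-unique : ∀ a k → Unique (range a k)
range-unique a k = Uniqueₚ.map⁺ (ℕₚ.+-cancelˡ-≡ a _ _) (Uniqueₚ.upTo⁺ k)

∈-letters⁻ : ∀ {z} → z ∈ letters n → 1 ≤ ∣ z ∣ × ∣ z ∣ ≤ n
∈-letters⁻ {n} z∈ with ∈-++⁻ (map (λ k → - (+ k)) (range 1 n)) z∈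
... | inj₁ neg with ∈-map⁻ _ neg
...   | zero , k∈ , refl with () ← proj₁ (∈-range⁻ k∈)
...   | suc k , k∈ , refl = s≤s z≤n , ℕₚ.≤-pred (proj₂ (∈-range⁻ k∈))
∈-letters⁻ {n} z∈ | inj₂ pos with ∈-map⁻ _ pos
...   | k , k∈ , refl = let 1≤k , k<1+n = ∈-range⁻ k∈ in 1≤k , ℕₚ.≤-pred k<1+n

∈-letters⁺ : ∀ {z} → 1 ≤ ∣ z ∣ → ∣ z ∣ ≤ n → z ∈ letters n
∈-letters⁺ {n} {+ k} 1≤k k≤n = ∈-++⁺ʳ _ (∈-map⁺ +_ (∈-range⁺ 1≤k (s≤s k≤n)))
∈-letters⁺ {n} { -[1+ k ]} 1≤k k≤n = ∈-++⁺ˡ (∈-map⁺ (λ k → - (+ k)) (∈-range⁺ 1≤k (s≤s k≤n)))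

letters-unique : ∀ n → Unique (letters n)
letters-unique n = Uniqueₚ.++⁺
  (Uniqueₚ.map⁺ (λ eq → ℤₚ.+-injective (ℤₚ.neg-injective eq)) (range-unique 1 n))
  (Uniqueₚ.map⁺ ℤₚ.+-injective (range-unique 1 n))
  λ (neg , pos) → negative≢positive (∈-map⁻ _ neg) (∈-map⁻ _ pos)
  where
  negative≢positive : ∀ {z} → ∃[ k ] k ∈ range 1 n × z ≡ - (+ k) → ∃[ k ] k ∈ range 1 n × z ≡ + k → ⊥
  negative≢positive (zero , k∈ , _) _ with () ← proj₁ (∈-range⁻ k∈)
  negative≢positive (suc _ , _ , refl) (_ , _ , ())

∈-words⁻ : ∀ {X} {v : Vec ℤ k} → v ∈ words X k → All (_∈ X) (toList v)
∈-words⁻ {zero} {v = Vec.[]} _ = []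
∈-words⁻ {suc k} {X} {v = x Vec.∷ v} v∈
  with a , a∈ , v∈a ← find (∈-concatMap⁻ (λ a → map (a Vec.∷_) (words X k)) {xs = X} v∈)
  with w , w∈ , eq ← ∈-map⁻ _ v∈a
  with refl , refl ← Vecₚ.∷-injective eq
  = a∈ ∷ ∈-words⁻ w∈

∈-words⁺ : ∀ {X} (v : Vec ℤ k) → All (_∈ X) (toList v) → v ∈ words X k
∈-words⁺ Vec.[] _ = here refl
∈-words⁺ {suc k} {X} (x Vec.∷ v) (x∈ ∷ v∈) =
  ∈-concatMap⁺ (λ a → map (a Vec.∷_) (words X k)) {xs = X}
    (Any.map (λ { refl → ∈-map⁺ (x Vec.∷_) (∈-words⁺ v v∈) }) x∈)

words-unique : ∀ {X} k → Unique X → Unique (words X k)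
words-unique zero _ = [] ∷ []
words-unique {X} (suc k) X! = unique-concatMap⁺ X!
  (λ _ → Uniqueₚ.map⁺ (λ eq → proj₂ (Vecₚ.∷-injective eq)) (words-unique k X!))
  λ _ _ b∈a b∈a' → sameHead (∈-map⁻ _ b∈a) (∈-map⁻ _ b∈a')
  where
  sameHead : ∀ {a a' b} → ∃[ w ] w ∈ words X k × b ≡ a Vec.∷ w → ∃[ w ] w ∈ words X k × b ≡ a' Vec.∷ w → a ≡ a'
  sameHead (_ , _ , refl) (_ , _ , eq) = proj₁ (Vecₚ.∷-injective eq)


insertions : A → Vec A k → List (Vec A (suc k))
insertions x Vec.[]       = (x Vec.∷ Vec.[]) ∷ []
insertions x (y Vec.∷ w)  = (x Vec.∷ y Vec.∷ w) ∷ map (y Vec.∷_) (insertions x w)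

∈-insertions⇒↭ : ∀ {x : A} {w : Vec A k} {u} → u ∈ insertions x w → toList u ↭ x ∷ toList w
∈-insertions⇒↭ {w = Vec.[]} (here refl) = ↭-refl
∈-insertions⇒↭ {w = y Vec.∷ w} (here refl) = ↭-refl
∈-insertions⇒↭ {x = x} {w = y Vec.∷ w} (there u∈) with u' , u'∈ , refl ← ∈-map⁻ (y Vec.∷_) u∈ =
  ↭-trans (prep y (∈-insertions⇒↭ u'∈)) (swap y x ↭-refl)

∷∈insertions : ∀ (x : A) (w : Vec A k) → x Vec.∷ w ∈ insertions x w
∷∈insertions x Vec.[]      = here refl
∷∈insertions x (_ Vec.∷ _) = here refl

Any⇒∈-insertions : ∀ {P : A → Set} (v : Vec A (suc n)) → Any P (toList v) →
  ∃₂ λ x (w : Vec A n) → P x × v ∈ insertions x w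
Any⇒∈-insertions (x Vec.∷ w) (here px) = x , w , px , ∷∈insertions x w
Any⇒∈-insertions {n = zero} (_ Vec.∷ Vec.[]) (there ())
Any⇒∈-insertions {n = suc n} (y Vec.∷ v) (there pv) with x , w , px , v∈ ← Any⇒∈-insertions v pv =
  x , y Vec.∷ w , px , there (∈-map⁺ (y Vec.∷_) v∈)

insertions-unique : ∀ {x : A} (w : Vec A k) → x ∉ toList w → Unique (insertions x w)
insertions-unique Vec.[] _ = [] ∷ []
insertions-unique {x = x} (y Vec.∷ w) x∉ =
  All.tabulate (λ u∈ eq → headDiffers (∈-map⁻ _ u∈) eq) ∷
  Uniqueₚ.map⁺ (proj₂ ∘ Vecₚ.∷-injective) (insertions-unique w (x∉ ∘ there))
  where
  headDiffers : ∀ {v} → ∃[ u ] u ∈ insertions x w × v ≡ y Vec.∷ u → x Vec.∷ y Vec.∷ w ≢ v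
  headDiffers (_ , _ , refl) eq = x∉ (here (proj₁ (Vecₚ.∷-injective eq)))

insertions-injective : ∀ {x x' : A} {w w' : Vec A k} {u} → x ∉ toList w' → x' ∉ toList w →
  u ∈ insertions x w → u ∈ insertions x' w' → x ≡ x' × w ≡ w'
insertions-injective {w = Vec.[]} {Vec.[]} _ _ (here refl) (here eq) = proj₁ (Vecₚ.∷-injective eq) , refl
insertions-injective {w = y Vec.∷ w} {y' Vec.∷ w'} x∉ x'∉ u∈ u∈' with u∈ | u∈'
... | here refl | here refl = refl , refl
... | here refl | there v∈' with _ , _ , eq ← ∈-map⁻ _ v∈' = ⊥-elim (x∉ (here (proj₁ (Vecₚ.∷-injective eq))))
... | there v∈ | here refl with _ , _ , eq ← ∈-map⁻ _ v∈ = ⊥-elim (x'∉ (here (proj₁ (Vecₚ.∷-injective eq))))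
... | there v∈ | there v∈' with u₁ , u₁∈ , refl ← ∈-map⁻ _ v∈ with u₂ , u₂∈ , eq ← ∈-map⁻ _ v∈'
  with refl , refl ← Vecₚ.∷-injective eq with refl , refl ← insertions-injective (x∉ ∘ there) (x'∉ ∘ there) u₁∈ u₂∈ = refl , refl

linked-insertions : ∀ {p x : A} {w : Vec A k} {u} → p ≢ x → x ∉ toList w → Linked _≢_ (p ∷ toList w) →
  u ∈ insertions x w → Linked _≢_ (p ∷ toList u)
linked-insertions {w = Vec.[]}    p≢x _  _          (here refl) = p≢x ∷ [-]
linked-insertions {w = y Vec.∷ w} p≢x x∉ (_ ∷ y∷w)  (here refl) = p≢x ∷ (x∉ ∘ here) ∷ y∷w
linked-insertions {w = y Vec.∷ w} p≢x x∉ (p≢y ∷ y∷w) (there u∈) with _ , u∈' , refl ← ∈-map⁻ _ u∈ =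
  p≢y ∷ linked-insertions (λ y≡x → x∉ (here (sym y≡x))) (x∉ ∘ there) y∷w u∈'


-- Signed permutations built by inserting ±n

extensions : Vec ℤ n → List (Vec ℤ (suc n))
extensions {n} w = insertions (+ suc n) w ++ insertions (- (+ suc n)) w

signedPerms : (n : ℕ) → List (Vec ℤ n)
signedPerms zero    = Vec.[] ∷ []
signedPerms (suc n) = concatMap extensions (signedPerms n)

Covers : ℕ → Vec ℤ n → Set
Covers k v = ∀ {j} → 1 ≤ j → j ≤ k → Any (λ z → ∣ z ∣ ≡ j) (toList v)

covers-insertions⁻ : ∀ {k x} {w : Vec ℤ n} {u} → u ∈ insertions x w → k < ∣ x ∣ → Covers k u → Covers k w
covers-insertions⁻ {x = x} u∈ k<∣x∣ cov 1≤j j≤k with Any-resp-↭ (∈-insertions⇒↭ u∈) (cov 1≤j j≤k)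
... | here ∣x∣≡j = ⊥-elim (ℕₚ.<-irrefl (sym ∣x∣≡j) (ℕₚ.≤-<-trans j≤k k<∣x∣))
... | there hit  = hit

covers-≤ : ∀ k (v : Vec ℤ n) → Covers k v → k ≤ n
covers-≤ zero v _ = z≤n
covers-≤ (suc k) Vec.[] cov with () ← cov (s≤s z≤n) ℕₚ.≤-refl
covers-≤ (suc k) v@(_ Vec.∷ _) cov with x , w , ∣x∣≡ , v∈ ← Any⇒∈-insertions v (cov (s≤s z≤n) ℕₚ.≤-refl) =
  s≤s (covers-≤ k w (covers-insertions⁻ v∈ (ℕₚ.≤-reflexive (sym ∣x∣≡)) λ 1≤j j≤k → cov 1≤j (ℕₚ.m≤n⇒m≤1+n j≤k)))

signedPerm-covers : ∀ {v : Vec ℤ n} → IsSignedPerm n v → Covers n v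
signedPerm-covers (_ , cov) 1≤j j≤n = All.lookup cov (∈-range⁺ 1≤j (s≤s j≤n))

covers⇒coversRange : ∀ {v : Vec ℤ n} → Covers n v → All (λ k → Any (λ z → ∣ z ∣ ≡ k) (toList v)) (range 1 n)
covers⇒coversRange cov = All.tabulate λ j∈ → let 1≤j , j<1+n = ∈-range⁻ j∈ in cov 1≤j (ℕₚ.≤-pred j<1+n)

covers-suc : ∀ {m} {v : Vec ℤ m} → Covers n v → Any (λ z → ∣ z ∣ ≡ suc n) (toList v) → Covers (suc n) v
covers-suc {n} cov top {j} 1≤j j≤1+n with j ℕ.≟ suc n
... | yes refl = top
... | no j≢    = cov 1≤j (ℕₚ.≤-pred (ℕₚ.≤∧≢⇒< j≤1+n j≢))

insertion-signedPerm : ∀ {w : Vec ℤ n} {x u} → IsSignedPerm n w → ∣ x ∣ ≡ suc n → u ∈ insertions x w →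
  IsSignedPerm (suc n) u
insertion-signedPerm {n} sp@(ltrs , _) ∣x∣≡ u∈ =
  All-resp-↭ (↭-sym w↭) (∈-letters⁺ (subst (1 ≤_) (sym ∣x∣≡) (s≤s z≤n)) (ℕₚ.≤-reflexive ∣x∣≡) ∷ All.map widen ltrs) ,
  covers⇒coversRange (covers-suc (λ 1≤j j≤n → Any-resp-↭ (↭-sym w↭) (there (signedPerm-covers sp 1≤j j≤n)))
                                 (Any-resp-↭ (↭-sym w↭) (here ∣x∣≡)))
  where
  w↭ = ∈-insertions⇒↭ u∈
  widen : ∀ {z} → z ∈ letters n → z ∈ letters (suc n)
  widen z∈ = let 1≤∣z∣ , ∣z∣≤n = ∈-letters⁻ z∈ in ∈-letters⁺ 1≤∣z∣ (ℕₚ.m≤n⇒m≤1+n ∣z∣≤n)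

insertion-signedPerm⁻ : ∀ {w : Vec ℤ n} {x u} → IsSignedPerm (suc n) u → ∣ x ∣ ≡ suc n → u ∈ insertions x w →
  IsSignedPerm n w
insertion-signedPerm⁻ {n} {w} {x} sp ∣x∣≡ u∈ = All.tabulate letter , covers⇒coversRange covers
  where
  covers : Covers n w
  covers = covers-insertions⁻ u∈ (ℕₚ.≤-reflexive (sym ∣x∣≡)) λ 1≤j j≤n → signedPerm-covers sp 1≤j (ℕₚ.m≤n⇒m≤1+n j≤n)
  letter : ∀ {z} → z ∈ toList w → z ∈ letters n
  letter {z} z∈ with ∈-letters⁻ (All.lookup (proj₁ sp) (Any-resp-↭ (↭-sym (∈-insertions⇒↭ u∈)) (there z∈)))
  ... | 1≤∣z∣ , ∣z∣≤1+n with ∣ z ∣ ℕ.≟ suc n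
  ...   | no ∣z∣≢  = ∈-letters⁺ 1≤∣z∣ (ℕₚ.≤-pred (ℕₚ.≤∧≢⇒< ∣z∣≤1+n ∣z∣≢))
  ...   | yes ∣z∣≡ = ⊥-elim (ℕₚ.<-irrefl refl (covers-≤ (suc n) w (covers-suc covers (Any.map (λ { refl → ∣z∣≡ }) z∈))))

∈-extensions⁻ : ∀ {w : Vec ℤ n} {u} → u ∈ extensions w → ∃[ x ] ∣ x ∣ ≡ suc n × u ∈ insertions x w
∈-extensions⁻ {n} {w} u∈ with ∈-++⁻ (insertions (+ suc n) w) u∈
... | inj₁ u∈⁺ = + suc n , refl , u∈⁺
... | inj₂ u∈⁻ = - (+ suc n) , refl , u∈⁻

∈-extensions⁺ : ∀ {w : Vec ℤ n} {x u} → ∣ x ∣ ≡ suc n → u ∈ insertions x w → u ∈ extensions w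
∈-extensions⁺ {x = + _}      refl u∈ = ∈-++⁺ˡ u∈
∈-extensions⁺ {x = -[1+ _ ]} refl u∈ = ∈-++⁺ʳ _ u∈

signedPerms-sound : ∀ {v : Vec ℤ n} → v ∈ signedPerms n → IsSignedPerm n v
signedPerms-sound {zero} (here refl) = [] , []
signedPerms-sound {suc n} v∈
  with w , w∈ , v∈ext ← find (∈-concatMap⁻ extensions {xs = signedPerms n} v∈)
  with x , ∣x∣≡ , v∈ins ← ∈-extensions⁻ v∈ext
  = insertion-signedPerm (signedPerms-sound w∈) ∣x∣≡ v∈ins

signedPerms-complete : ∀ (v : Vec ℤ n) → IsSignedPerm n v → v ∈ signedPerms n
signedPerms-complete Vec.[] _ = here refl
signedPerms-complete {suc n} v sp
  with x , w , ∣x∣≡ , v∈ ← Any⇒∈-insertions v (signedPerm-covers sp (s≤s z≤n) ℕₚ.≤-refl)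
  = ∈-concatMap⁺ extensions {xs = signedPerms n}
      (Any.map (λ { refl → ∈-extensions⁺ ∣x∣≡ v∈ }) (signedPerms-complete w (insertion-signedPerm⁻ sp ∣x∣≡ v∈)))

signedPerm-∉ : ∀ {w : Vec ℤ n} {x} → IsSignedPerm n w → ∣ x ∣ ≡ suc n → x ∉ toList w
signedPerm-∉ {n} (ltrs , _) ∣x∣≡ x∈ = ℕₚ.1+n≰n (subst (_≤ _) ∣x∣≡ (proj₂ (∈-letters⁻ {n} (All.lookup ltrs x∈))))

signedPerms-unique : ∀ n → Unique (signedPerms n)
signedPerms-unique zero    = [] ∷ []
signedPerms-unique (suc n) = unique-concatMap⁺ (signedPerms-unique n) extensions-unique sameParent
  where
  fresh : ∀ {w x} → w ∈ signedPerms n → ∣ x ∣ ≡ suc n → x ∉ toList w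
  fresh w∈ = signedPerm-∉ (signedPerms-sound w∈)
  extensions-unique : ∀ {w} → w ∈ signedPerms n → Unique (extensions w)
  extensions-unique w∈ = Uniqueₚ.++⁺ (insertions-unique _ (fresh w∈ refl)) (insertions-unique _ (fresh w∈ refl))
    λ (u∈⁺ , u∈⁻) → case proj₁ (insertions-injective (fresh w∈ refl) (fresh w∈ refl) u∈⁺ u∈⁻) of λ ()
  sameParent : ∀ {w w' u} → w ∈ signedPerms n → w' ∈ signedPerms n → u ∈ extensions w → u ∈ extensions w' → w ≡ w'
  sameParent w∈ w'∈ u∈ u∈'
    with x , ∣x∣≡ , u∈x ← ∈-extensions⁻ u∈
    with x' , ∣x'∣≡ , u∈x' ← ∈-extensions⁻ u∈'
    = proj₂ (insertions-injective (fresh w'∈ ∣x∣≡) (fresh w∈ ∣x'∣≡) u∈x u∈x')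

filter-words↭signedPerms : ∀ n → filter (isSignedPerm? n) (words (letters n) n) ↭ signedPerms n
filter-words↭signedPerms n = ∼bag⇒↭ (unique∧set⇒bag
  (Uniqueₚ.filter⁺ (isSignedPerm? n) (words-unique n (letters-unique n)))
  (signedPerms-unique n)
  (mk⇔ (λ v∈ → let v∈words , sp = ∈-filter⁻ (isSignedPerm? n) {xs = words (letters n) n} v∈ in signedPerms-complete _ sp)
       (λ v∈ → let sp = signedPerms-sound v∈ in ∈-filter⁺ (isSignedPerm? n) (∈-words⁺ _ (proj₁ sp)) sp)))

signedPerms-linked : ∀ {v : Vec ℤ n} → v ∈ signedPerms n → Linked _≢_ (+ 0 ∷ toList v)
signedPerms-linked {zero} (here refl) = [-]
signedPerms-linked {suc n} v∈
  with w , w∈ , v∈ext ← find (∈-concatMap⁻ extensions {xs = signedPerms n} v∈)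
  with x , ∣x∣≡ , v∈ins ← ∈-extensions⁻ v∈ext
  = linked-insertions (λ 0≡x → ℕₚ.0≢1+n (trans (cong ∣_∣ 0≡x) ∣x∣≡))
      (signedPerm-∉ (signedPerms-sound w∈) ∣x∣≡) (signedPerms-linked w∈) v∈ins


-- Step words and their peaks

_<ᵇ_ : ℤ → ℤ → Bool
x <ᵇ y = does (x ℤₚ.<? y)

<ᵇ-true⁻ : ∀ {x y} → (x <ᵇ y) ≡ true → x ℤ.< y
<ᵇ-true⁻ {x} {y} e with x ℤₚ.<? y
... | yes x<y = x<y
... | no _ with () ← e

<ᵇ-false⁻ : ∀ {x y} → (x <ᵇ y) ≡ false → ¬ x ℤ.< y
<ᵇ-false⁻ {x} {y} e with x ℤₚ.<? y
... | no x≮y = x≮y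
... | yes _ with () ← e

ascents : ℤ → List ℤ → List Bool
ascents p []      = []
ascents p (x ∷ l) = (p <ᵇ x) ∷ ascents x l

stepWord : Vec ℤ n → List Bool
stepWord v = ascents (+ 0) (toList v)

length-ascents : ∀ p l → length (ascents p l) ≡ length l
length-ascents p []      = refl
length-ascents p (x ∷ l) = cong suc (length-ascents x l)

length-stepWord : (v : Vec ℤ n) → length (stepWord v) ≡ n
length-stepWord v = trans (length-ascents (+ 0) (toList v)) (Vecₚ.length-toList v)

stepInsertions : Bool → List Bool → List (List Bool)
stepInsertions b []      = (b ∷ []) ∷ []
stepInsertions b (c ∷ s) = (b ∷ not b ∷ s) ∷ map (c ∷_) (stepInsertions b s)

Extremal : Bool → ℤ → ℤ → Set
Extremal b x q = (q <ᵇ x) ≡ b × (x <ᵇ q) ≡ not b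

ascents-insertions : ∀ {b x p} (w : Vec ℤ k) → All (Extremal b x) (p ∷ toList w) →
  map (ascents p ∘ toList) (insertions x w) ≡ stepInsertions b (ascents p (toList w))
ascents-insertions Vec.[] ((p<x , _) ∷ []) rewrite p<x = refl
ascents-insertions {b = b} {x} {p} (y Vec.∷ w) ((p<x , _) ∷ ext@((_ , x<y) ∷ _)) rewrite p<x | x<y =
  cong ((b ∷ not b ∷ ascents y (toList w)) ∷_) (begin
    map (ascents p ∘ toList) (map (y Vec.∷_) (insertions x w))   ≡⟨ Listₚ.map-∘ (insertions x w) ⟨
    map (((p <ᵇ y) ∷_) ∘ ascents y ∘ toList) (insertions x w)    ≡⟨ Listₚ.map-∘ (insertions x w) ⟩
    map ((p <ᵇ y) ∷_) (map (ascents y ∘ toList) (insertions x w)) ≡⟨ cong (map ((p <ᵇ y) ∷_)) (ascents-insertions w ext) ⟩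
    map ((p <ᵇ y) ∷_) (stepInsertions b (ascents y (toList w)))  ∎)
  where open ≡-Reasoning

∣∣<⇒<+ : ∀ {M q} → ∣ q ∣ < M → q ℤ.< + M
∣∣<⇒<+ {q = + _}      ∣q∣<M = +<+ ∣q∣<M
∣∣<⇒<+ {q = -[1+ _ ]} _     = -<+

∣∣<⇒-< : ∀ {M q} → ∣ q ∣ < suc M → - (+ suc M) ℤ.< q
∣∣<⇒-< {q = + _}      _        = -<+
∣∣<⇒-< {q = -[1+ _ ]} ∣q∣<1+M = -<- (ℕₚ.≤-pred ∣q∣<1+M)

extremal-above : ∀ {M q} → ∣ q ∣ < M → Extremal true (+ M) q
extremal-above {M} {q} ∣q∣<M =
  dec-true (q ℤₚ.<? + M) (∣∣<⇒<+ ∣q∣<M) , dec-false (+ M ℤₚ.<? q) (ℤₚ.<-asym (∣∣<⇒<+ ∣q∣<M))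

extremal-below : ∀ {M q} → ∣ q ∣ < suc M → Extremal false (- (+ suc M)) q
extremal-below {M} {q} ∣q∣<1+M =
  dec-false (q ℤₚ.<? - (+ suc M)) (ℤₚ.<-asym (∣∣<⇒-< ∣q∣<1+M)) , dec-true (- (+ suc M) ℤₚ.<? q) (∣∣<⇒-< ∣q∣<1+M)

signedPerms-bounded : ∀ {v : Vec ℤ n} → v ∈ signedPerms n → All (λ z → ∣ z ∣ < suc n) (+ 0 ∷ toList v)
signedPerms-bounded {n} v∈ = s≤s z≤n ∷ All.map (λ z∈ → s≤s (proj₂ (∈-letters⁻ {n} z∈))) (proj₁ (signedPerms-sound v∈))

stepWord-extensions : ∀ {w : Vec ℤ n} → w ∈ signedPerms n →
  map stepWord (extensions w) ≡ stepInsertions true (stepWord w) ++ stepInsertions false (stepWord w)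
stepWord-extensions {n} {w} w∈ = trans (Listₚ.map-++ stepWord (insertions (+ suc n) w) _)
  (cong₂ _++_ (ascents-insertions w (All.map (λ {q} → extremal-above {q = q}) (signedPerms-bounded w∈)))
              (ascents-insertions w (All.map (λ {q} → extremal-below {q = q}) (signedPerms-bounded w∈))))


isPeakᵇ : List Bool → ℕ → Bool
isPeakᵇ (_ ∷ s)     (suc (suc i)) = isPeakᵇ s (suc i)
isPeakᵇ (c ∷ d ∷ _) 1             = c ∧ not d
isPeakᵇ _           _             = false

Interior : List Bool → ℕ → Set
Interior s i = 1 ≤ i × suc i ≤ length s

entryFrom : ℤ → List ℤ → ℕ → ℤ
entryFrom p _       zero    = p
entryFrom p []      (suc i) = + 0
entryFrom p (x ∷ l) (suc i) = entryFrom x l i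

entry-suc≡entryFrom : ∀ p l i → entry l (suc i) ≡ entryFrom p l (suc i)
entry-suc≡entryFrom p []      i       = refl
entry-suc≡entryFrom p (x ∷ l) zero    = refl
entry-suc≡entryFrom p (x ∷ l) (suc i) = entry-suc≡entryFrom x l i

entry≡entryFrom : ∀ l i → entry l i ≡ entryFrom (+ 0) l i
entry≡entryFrom l zero    = refl
entry≡entryFrom l (suc i) = entry-suc≡entryFrom (+ 0) l i

IsPeakFrom : ℤ → List ℤ → ℕ → Set
IsPeakFrom p l i = (entryFrom p l (i ∸ 1) ℤ.< entryFrom p l i) × (entryFrom p l (suc i) ℤ.< entryFrom p l i)

∧-not≡true : ∀ {a b} → a ∧ not b ≡ true → a ≡ true × b ≡ false
∧-not≡true {true} {false} _ = refl , refl

isPeakFrom⇔isPeakᵇ : ∀ p l i → Linked _≢_ (p ∷ l) → Interior (ascents p l) i →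
  IsPeakFrom p l i ⇔ (isPeakᵇ (ascents p l) i ≡ true)
isPeakFrom⇔isPeakᵇ p (x ∷ []) 1 _ (_ , s≤s ())
isPeakFrom⇔isPeakᵇ p (x ∷ y ∷ l) 1 (_ ∷ x≢y ∷ _) _ = mk⇔
  (λ (p<x , y<x) → cong₂ (λ a b → a ∧ not b) (dec-true (p ℤₚ.<? x) p<x) (dec-false (x ℤₚ.<? y) (ℤₚ.<-asym y<x)))
  (λ e → let p<ᵇx , x<ᵇy = ∧-not≡true e in
    <ᵇ-true⁻ p<ᵇx , ℤₚ.≤∧≢⇒< (ℤₚ.≮⇒≥ (<ᵇ-false⁻ x<ᵇy)) (x≢y ∘ sym))
isPeakFrom⇔isPeakᵇ p (x ∷ l) (suc (suc i)) (_ ∷ linked) (_ , s≤s 2+i≤) =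
  isPeakFrom⇔isPeakᵇ x l (suc i) linked (s≤s z≤n , 2+i≤)

isPeak⇔isPeakᵇ : ∀ {v : Vec ℤ n} {i} → Linked _≢_ (+ 0 ∷ toList v) → Interior (stepWord v) i →
  IsPeak v i ⇔ (isPeakᵇ (stepWord v) i ≡ true)
isPeak⇔isPeakᵇ {v = v} {i} linked int = mk⇔
  (Equivalence.to peak⇔ ∘ subst id isPeak≡isPeakFrom)
  (subst id (sym isPeak≡isPeakFrom) ∘ Equivalence.from peak⇔)
  where
  peak⇔ = isPeakFrom⇔isPeakᵇ (+ 0) (toList v) i linked int
  isPeak≡isPeakFrom : IsPeak v i ≡ IsPeakFrom (+ 0) (toList v) i
  isPeak≡isPeakFrom = cong₂ _×_
    (cong₂ ℤ._<_ (entry≡entryFrom (toList v) (i ∸ 1)) (entry≡entryFrom (toList v) i))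
    (cong₂ ℤ._<_ (entry≡entryFrom (toList v) (suc i)) (entry≡entryFrom (toList v) i))

SinglePeak : List Bool → ℕ → Set
SinglePeak s m = ∀ {i} → Interior s i → (isPeakᵇ s i ≡ true) ⇔ (i ≡ m)

interior-stepWord⇔∈-range : ∀ (v : Vec ℤ n) {i} → Interior (stepWord v) i ⇔ i ∈ range 1 (n ∸ 1)
interior-stepWord⇔∈-range {n} v {i} = mk⇔
  (λ (1≤i , 1+i≤) → ∈-range⁺ 1≤i (to (subst (suc i ≤_) (length-stepWord v) 1+i≤)))
  (λ i∈ → let 1≤i , i<1+[n∸1] = ∈-range⁻ i∈ in 1≤i , subst (suc i ≤_) (sym (length-stepWord v)) (from 1≤i i<1+[n∸1]))
  where
  to : ∀ {n} → suc i ≤ n → i < 1 + (n ∸ 1)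
  to {suc n} 1+i≤n = 1+i≤n
  from : ∀ {n} → 1 ≤ i → i < 1 + (n ∸ 1) → suc i ≤ n
  from {zero}  1≤i (s≤s i≤0) = ⊥-elim (ℕₚ.<-irrefl refl (ℕₚ.≤-trans 1≤i i≤0))
  from {suc n} _   i<n       = i<n

peakSetIsSingleton⇔singlePeak : ∀ {v : Vec ℤ n} {m} → v ∈ signedPerms n →
  PeakSetIsSingleton v m ⇔ SinglePeak (stepWord v) m
peakSetIsSingleton⇔singlePeak {n} {v} {m} v∈ = mk⇔
  (λ single {i} int → let peak⇔ = isPeak⇔isPeakᵇ (signedPerms-linked v∈) int
                          at-i = All.lookup single (Equivalence.to (interior-stepWord⇔∈-range v) int)
                      in mk⇔ (proj₁ at-i ∘ Equivalence.from peak⇔) (Equivalence.to peak⇔ ∘ proj₂ at-i))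
  (λ single → All.tabulate λ i∈ →
     let int = Equivalence.from (interior-stepWord⇔∈-range v) i∈
         peak⇔ = isPeak⇔isPeakᵇ (signedPerms-linked v∈) int
     in Equivalence.to (single int) ∘ Equivalence.to peak⇔ , Equivalence.from peak⇔ ∘ Equivalence.from (single int))


-- Peak classes

data PeakClass : Set where
  noPeak    : Bool → PeakClass
  onePeak   : ℕ → Bool → PeakClass
  manyPeaks : PeakClass

prepend : Bool → PeakClass → PeakClass
prepend _     manyPeaks         = manyPeaks
prepend true  (noPeak false)    = noPeak false
prepend true  (noPeak true)     = onePeak 1 false
prepend true  (onePeak j false) = onePeak (suc j) false
prepend true  (onePeak j true)  = manyPeaks
prepend false (noPeak _)        = noPeak true
prepend false (onePeak j _)     = onePeak (suc j) true

classOf : List Bool → PeakClass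
classOf = foldr prepend (noPeak false)

startsDown : List Bool → Bool
startsDown []      = false
startsDown (c ∷ _) = not c

NoPeak : List Bool → Set
NoPeak s = ∀ {i} → Interior s i → isPeakᵇ s i ≡ false

data Classifies (s : List Bool) : PeakClass → Set where
  noPeak    : ∀ {h} → h ≡ startsDown s → NoPeak s → Classifies s (noPeak h)
  onePeak   : ∀ {j h} → h ≡ startsDown s → Interior s j → SinglePeak s j → Classifies s (onePeak j h)
  manyPeaks : ∀ {i i'} → i ≢ i' → Interior s i → Interior s i' → isPeakᵇ s i ≡ true → isPeakᵇ s i' ≡ true →
              Classifies s manyPeaks

interior-∷ : ∀ {c s i} → Interior s i → Interior (c ∷ s) (suc i)
interior-∷ (_ , 1+i≤) = s≤s z≤n , s≤s 1+i≤

interior-∷⁻ : ∀ {c s i} → Interior (c ∷ s) (suc (suc i)) → Interior s (suc i)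
interior-∷⁻ (_ , s≤s 2+i≤) = s≤s z≤n , 2+i≤

isPeakᵇ-false-∷ : ∀ s → isPeakᵇ (false ∷ s) 1 ≡ false
isPeakᵇ-false-∷ []      = refl
isPeakᵇ-false-∷ (_ ∷ _) = refl

isPeakᵇ-true-∷ : ∀ s → isPeakᵇ (true ∷ s) 1 ≡ startsDown s
isPeakᵇ-true-∷ []      = refl
isPeakᵇ-true-∷ (_ ∷ _) = refl

noPeak-∷ : ∀ {c s} → NoPeak s → isPeakᵇ (c ∷ s) 1 ≡ false → NoPeak (c ∷ s)
noPeak-∷             _  first {1}           _   = first
noPeak-∷ {c} {s} np _     {suc (suc i)} int = np (interior-∷⁻ {c} {s} int)

singlePeak-∷ : ∀ {c s j} → 1 ≤ j → SinglePeak s j → isPeakᵇ (c ∷ s) 1 ≡ false → SinglePeak (c ∷ s) (suc j)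
singlePeak-∷ {j = suc j} _ _ first {1} _ = mk⇔ (λ peak → case trans (sym first) peak of λ ()) (λ ())
singlePeak-∷ {c} {s} _ single _ {suc (suc i)} int =
  mk⇔ (cong suc ∘ Equivalence.to (single int′)) (Equivalence.from (single int′) ∘ ℕₚ.suc-injective)
  where int′ = interior-∷⁻ {c} {s} int

classifies-∷ : ∀ c s {K} → Classifies s K → Classifies (c ∷ s) (prepend c K)
classifies-∷ true s (noPeak {false} h≡ np) = noPeak refl (noPeak-∷ np (trans (isPeakᵇ-true-∷ s) (sym h≡)))
classifies-∷ true (d ∷ s) (noPeak {true} h≡ np) = onePeak refl (s≤s z≤n , s≤s (s≤s z≤n)) single
  where
  single : SinglePeak (true ∷ d ∷ s) 1
  single {1} _ = mk⇔ (λ _ → refl) (λ _ → sym h≡)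
  single {suc (suc i)} int = mk⇔ (λ peak → case trans (sym (np (interior-∷⁻ {true} {d ∷ s} int))) peak of λ ()) (λ ())
classifies-∷ true s (onePeak {j} {false} h≡ int single) =
  onePeak refl (interior-∷ {true} {s} int) (singlePeak-∷ (proj₁ int) single (trans (isPeakᵇ-true-∷ s) (sym h≡)))
classifies-∷ true s (onePeak {suc j} {true} h≡ int single) =
  manyPeaks (λ ()) (s≤s z≤n , s≤s (ℕₚ.≤-trans (s≤s z≤n) (proj₂ int))) (interior-∷ {true} {s} int)
    (trans (isPeakᵇ-true-∷ s) (sym h≡)) (Equivalence.from (single int) refl)
classifies-∷ false s (noPeak _ np) = noPeak refl (noPeak-∷ np (isPeakᵇ-false-∷ s))
classifies-∷ false s (onePeak _ int single) =
  onePeak refl (interior-∷ {false} {s} int) (singlePeak-∷ (proj₁ int) single (isPeakᵇ-false-∷ s))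
classifies-∷ c s (manyPeaks {suc i} {suc i'} i≢i' int int' peak peak') =
  manyPeaks (i≢i' ∘ ℕₚ.suc-injective) (interior-∷ {c} {s} int) (interior-∷ {c} {s} int') peak peak'

classifies-classOf : ∀ s → Classifies s (classOf s)
classifies-classOf []      = noPeak refl λ ()
classifies-classOf (c ∷ s) = classifies-∷ c s (classifies-classOf s)

classifies-singlePeak : ∀ {s m K} → Classifies s K → SinglePeak s m → Interior s m → ∃[ h ] K ≡ onePeak m h
classifies-singlePeak (noPeak _ np) single int = case trans (sym (np int)) (Equivalence.from (single int) refl) of λ ()
classifies-singlePeak (onePeak {h = h} _ intj singlej) single _
  rewrite Equivalence.to (single intj) (Equivalence.from (singlej intj) refl) = h , refl
classifies-singlePeak (manyPeaks i≢i' int int' peak peak') single _ =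
  ⊥-elim (i≢i' (trans (Equivalence.to (single int) peak) (sym (Equivalence.to (single int') peak'))))

classifies-onePeak : ∀ {s m h} → Classifies s (onePeak m h) → Interior s m × SinglePeak s m
classifies-onePeak (onePeak _ int single) = int , λ {i} → single {i}

singlePeak⇔classOf≡onePeak : ∀ s {m} → Interior s m → SinglePeak s m ⇔ (∃[ h ] classOf s ≡ onePeak m h)
singlePeak⇔classOf≡onePeak s {m} int = mk⇔
  (λ (single : SinglePeak s m) → classifies-singlePeak (classifies-classOf s) single int)
  (λ (h , eq) → proj₂ (classifies-onePeak (subst (Classifies s) eq (classifies-classOf s))))


_≐_ : Bool → Bool → Bool
h ≐ h' = not (h xor h')

_==_ : PeakClass → PeakClass → Bool
noPeak h    == noPeak h'    = h ≐ h'
onePeak j h == onePeak m h' = (h ≐ h') ∧ (j ≡ᵇ m)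
manyPeaks   == manyPeaks    = true
_           == _            = false

δ : PeakClass → PeakClass → ℕ
δ K K' = 𝟙 (K == K')

data AtMostOnePeak : PeakClass → Set where
  noPeak  : ∀ h → AtMostOnePeak (noPeak h)
  onePeak : ∀ m h → AtMostOnePeak (onePeak m h)

preimages : Bool → PeakClass → List PeakClass
preimages true  (noPeak false)                = noPeak false ∷ []
preimages false (noPeak true)                 = noPeak false ∷ noPeak true ∷ []
preimages true  (onePeak 1 false)             = noPeak true ∷ onePeak 0 false ∷ []
preimages true  (onePeak (suc (suc m)) false) = onePeak (suc m) false ∷ []
preimages false (onePeak (suc m) true)        = onePeak m false ∷ onePeak m true ∷ []
preimages _     _                             = []

δ-prepend : ∀ c K {K'} → AtMostOnePeak K' → δ (prepend c K) K' ≡ sum (map (δ K) (preimages c K'))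
δ-prepend true  (noPeak false)    (noPeak false)                = refl
δ-prepend true  (noPeak true)     (noPeak false)                = refl
δ-prepend true  (onePeak j false) (noPeak false)                = refl
δ-prepend true  (onePeak j true)  (noPeak false)                = refl
δ-prepend true  manyPeaks         (noPeak false)                = refl
δ-prepend true  (noPeak false)    (noPeak true)                 = refl
δ-prepend true  (noPeak true)     (noPeak true)                 = refl
δ-prepend true  (onePeak j false) (noPeak true)                 = refl
δ-prepend true  (onePeak j true)  (noPeak true)                 = refl
δ-prepend true  manyPeaks         (noPeak true)                 = refl
δ-prepend true  (noPeak true)     (onePeak 0 false)             = refl
δ-prepend true  (onePeak j false) (onePeak 0 false)             = refl
δ-prepend true  (noPeak true)     (onePeak 0 true)              = refl
δ-prepend true  (onePeak j false) (onePeak 0 true)              = refl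
δ-prepend true  (noPeak false)    (onePeak 0 h′)                = refl
δ-prepend true  (onePeak j true)  (onePeak 0 h′)                = refl
δ-prepend true  manyPeaks         (onePeak 0 h′)                = refl
δ-prepend true  (noPeak false)    (onePeak 1 false)             = refl
δ-prepend true  (noPeak true)     (onePeak 1 false)             = refl
δ-prepend true  (onePeak j false) (onePeak 1 false)             = sym (ℕₚ.+-identityʳ _)
δ-prepend true  (onePeak j true)  (onePeak 1 false)             = refl
δ-prepend true  manyPeaks         (onePeak 1 false)             = refl
δ-prepend true  (noPeak false)    (onePeak 1 true)              = refl
δ-prepend true  (noPeak true)     (onePeak 1 true)              = refl
δ-prepend true  (onePeak j false) (onePeak 1 true)              = refl
δ-prepend true  (onePeak j true)  (onePeak 1 true)              = refl
δ-prepend true  manyPeaks         (onePeak 1 true)              = refl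
δ-prepend true  (noPeak false)    (onePeak (suc (suc m)) false) = refl
δ-prepend true  (noPeak true)     (onePeak (suc (suc m)) false) = refl
δ-prepend true  (onePeak j false) (onePeak (suc (suc m)) false) = sym (ℕₚ.+-identityʳ _)
δ-prepend true  (onePeak j true)  (onePeak (suc (suc m)) false) = refl
δ-prepend true  manyPeaks         (onePeak (suc (suc m)) false) = refl
δ-prepend true  (noPeak false)    (onePeak (suc (suc m)) true)  = refl
δ-prepend true  (noPeak true)     (onePeak (suc (suc m)) true)  = refl
δ-prepend true  (onePeak j false) (onePeak (suc (suc m)) true)  = refl
δ-prepend true  (onePeak j true)  (onePeak (suc (suc m)) true)  = refl
δ-prepend true  manyPeaks         (onePeak (suc (suc m)) true)  = refl
δ-prepend false (noPeak h)        (noPeak false)                = refl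
δ-prepend false (onePeak j h)     (noPeak false)                = refl
δ-prepend false manyPeaks         (noPeak false)                = refl
δ-prepend false (noPeak false)    (noPeak true)                 = refl
δ-prepend false (noPeak true)     (noPeak true)                 = refl
δ-prepend false (onePeak j h)     (noPeak true)                 = refl
δ-prepend false manyPeaks         (noPeak true)                 = refl
δ-prepend false (onePeak j h)     (onePeak 0 false)             = refl
δ-prepend false (onePeak j h)     (onePeak 0 true)              = refl
δ-prepend false (noPeak h)        (onePeak 0 h′)                = refl
δ-prepend false manyPeaks         (onePeak 0 h′)                = refl
δ-prepend false (noPeak h)        (onePeak (suc m) false)       = refl
δ-prepend false (onePeak j h)     (onePeak (suc m) false)       = refl
δ-prepend false manyPeaks         (onePeak (suc m) false)       = refl
δ-prepend false (noPeak h)        (onePeak (suc m) true)        = refl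
δ-prepend false (onePeak j false) (onePeak (suc m) true)        = sym (ℕₚ.+-identityʳ _)
δ-prepend false (onePeak j true)  (onePeak (suc m) true)        = sym (ℕₚ.+-identityʳ _)
δ-prepend false manyPeaks         (onePeak (suc m) true)        = refl

-- transfer b K K' is the number of ways to insert a letter above (b = true) or below (b = false)
-- all others into a step word of class K so that the result has class K'; see arrivals≡transfer.
transfer : Bool → PeakClass → PeakClass → ℕ
transfer true  (noPeak h)        (noPeak h')                = 𝟙 (h ≐ h')
transfer true  (noPeak h)        (onePeak 1 h')             = 𝟙 (not h')
transfer true  (noPeak h)        (onePeak (suc (suc m)) h') = 𝟙 (h ≐ h')
transfer true  (onePeak j h)     (onePeak m h')             = if h ≐ h' then 2 * 𝟙 (j ≡ᵇ m) + 𝟙 (suc j ≡ᵇ m) else 0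
transfer false (noPeak false)    (noPeak h')                = 𝟙 h'
transfer false (noPeak true)     (noPeak h')                = 2 * 𝟙 h'
transfer false (noPeak false)    (onePeak (suc m) h')       = 𝟙 (not h')
transfer false (noPeak true)     (onePeak (suc (suc m)) h') = 𝟙 h'
transfer false (onePeak j false) (onePeak m h')             = 2 * 𝟙 (not h' ∧ (j ≡ᵇ m)) + 𝟙 (h' ∧ (suc j ≡ᵇ m))
transfer false (onePeak j true)  (onePeak m h')             = if h' then 2 * 𝟙 (j ≡ᵇ m) + 2 * 𝟙 (suc j ≡ᵇ m) else 0
transfer _     _                 _                          = 0

transfer-prepend : ∀ b c K {K'} → AtMostOnePeak K' →
  transfer b (prepend c K) K' ≡ δ (prepend b (prepend (not b) K)) K' + sum (map (transfer b K) (preimages c K'))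
transfer-prepend true  true  (noPeak false)    (noPeak false)                      = refl
transfer-prepend true  true  (noPeak true)     (noPeak false)                      = refl
transfer-prepend true  true  (onePeak j false) (noPeak false)                      = refl
transfer-prepend true  true  (onePeak j true)  (noPeak false)                      = refl
transfer-prepend true  true  manyPeaks         (noPeak false)                      = refl
transfer-prepend true  true  (noPeak false)    (noPeak true)                       = refl
transfer-prepend true  true  (noPeak true)     (noPeak true)                       = refl
transfer-prepend true  true  (onePeak j false) (noPeak true)                       = refl
transfer-prepend true  true  (onePeak j true)  (noPeak true)                       = refl
transfer-prepend true  true  manyPeaks         (noPeak true)                       = refl
transfer-prepend true  true  (noPeak false)    (onePeak 0 false)                   = refl
transfer-prepend true  true  (noPeak true)     (onePeak 0 false)                   = refl
transfer-prepend true  true  (onePeak j false) (onePeak 0 false)                   = refl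
transfer-prepend true  true  (noPeak false)    (onePeak 0 true)                    = refl
transfer-prepend true  true  (noPeak true)     (onePeak 0 true)                    = refl
transfer-prepend true  true  (onePeak j false) (onePeak 0 true)                    = refl
transfer-prepend true  true  (onePeak j true)  (onePeak 0 h′)                      = refl
transfer-prepend true  true  manyPeaks         (onePeak 0 h′)                      = refl
transfer-prepend true  true  (noPeak false)    (onePeak 1 false)                   = refl
transfer-prepend true  true  (noPeak true)     (onePeak 1 false)                   = refl
transfer-prepend true  true  (onePeak j false) (onePeak 1 false)                   = sym (ℕₚ.+-identityʳ _)
transfer-prepend true  true  (onePeak j true)  (onePeak 1 false)                   = refl
transfer-prepend true  true  manyPeaks         (onePeak 1 false)                   = refl
transfer-prepend true  true  (noPeak false)    (onePeak 1 true)                    = refl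
transfer-prepend true  true  (noPeak true)     (onePeak 1 true)                    = refl
transfer-prepend true  true  (onePeak j false) (onePeak 1 true)                    = refl
transfer-prepend true  true  (onePeak j true)  (onePeak 1 true)                    = refl
transfer-prepend true  true  manyPeaks         (onePeak 1 true)                    = refl
transfer-prepend true  true  (noPeak false)    (onePeak 2 false)                   = refl
transfer-prepend true  true  (noPeak true)     (onePeak 2 false)                   = refl
transfer-prepend true  true  (onePeak j false) (onePeak (suc (suc m)) false)       = sym (ℕₚ.+-identityʳ _)
transfer-prepend true  true  (onePeak j true)  (onePeak (suc (suc m)) false)       = refl
transfer-prepend true  true  manyPeaks         (onePeak (suc (suc m)) false)       = refl
transfer-prepend true  true  (noPeak false)    (onePeak (suc (suc m)) true)        = refl
transfer-prepend true  true  (noPeak true)     (onePeak (suc (suc m)) true)        = refl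
transfer-prepend true  true  (onePeak j false) (onePeak (suc (suc m)) true)        = refl
transfer-prepend true  true  (onePeak j true)  (onePeak (suc (suc m)) true)        = refl
transfer-prepend true  true  manyPeaks         (onePeak (suc (suc m)) true)        = refl
transfer-prepend true  true  (noPeak false)    (onePeak (suc (suc (suc m))) false) = refl
transfer-prepend true  true  (noPeak true)     (onePeak (suc (suc (suc m))) false) = refl
transfer-prepend true  false (noPeak h)        (noPeak false)                      = refl
transfer-prepend true  false (onePeak j h)     (noPeak false)                      = refl
transfer-prepend true  false manyPeaks         (noPeak false)                      = refl
transfer-prepend true  false (noPeak false)    (noPeak true)                       = refl
transfer-prepend true  false (noPeak true)     (noPeak true)                       = refl
transfer-prepend true  false (onePeak j h)     (noPeak true)                       = refl
transfer-prepend true  false manyPeaks         (noPeak true)                       = refl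
transfer-prepend true  false (noPeak h)        (onePeak 0 false)                   = refl
transfer-prepend true  false (onePeak j h)     (onePeak 0 false)                   = refl
transfer-prepend true  false (noPeak h)        (onePeak 0 true)                    = refl
transfer-prepend true  false (onePeak j h)     (onePeak 0 true)                    = refl
transfer-prepend true  false manyPeaks         (onePeak 0 h′)                      = refl
transfer-prepend true  false (noPeak h)        (onePeak 1 false)                   = refl
transfer-prepend true  false (noPeak h)        (onePeak 1 true)                    = refl
transfer-prepend true  false (noPeak h)        (onePeak 2 true)                    = refl
transfer-prepend true  false (onePeak j h)     (onePeak (suc m) false)             = refl
transfer-prepend true  false manyPeaks         (onePeak (suc m) false)             = refl
transfer-prepend true  false (onePeak j false) (onePeak (suc m) true)              = sym (ℕₚ.+-identityʳ _)
transfer-prepend true  false (onePeak j true)  (onePeak (suc m) true)              = sym (ℕₚ.+-identityʳ _)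
transfer-prepend true  false manyPeaks         (onePeak (suc m) true)              = refl
transfer-prepend true  false (noPeak h)        (onePeak (suc (suc m)) false)       = refl
transfer-prepend true  false (noPeak false)    (onePeak (suc (suc (suc m))) true)  = refl
transfer-prepend true  false (noPeak true)     (onePeak (suc (suc (suc m))) true)  = refl
transfer-prepend false true  (noPeak false)    (noPeak false)                      = refl
transfer-prepend false true  (noPeak true)     (noPeak false)                      = refl
transfer-prepend false true  (onePeak j false) (noPeak false)                      = refl
transfer-prepend false true  (onePeak j true)  (noPeak false)                      = refl
transfer-prepend false true  manyPeaks         (noPeak false)                      = refl
transfer-prepend false true  (noPeak false)    (noPeak true)                       = refl
transfer-prepend false true  (noPeak true)     (noPeak true)                       = refl
transfer-prepend false true  (onePeak j false) (noPeak true)                       = refl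
transfer-prepend false true  (onePeak j true)  (noPeak true)                       = refl
transfer-prepend false true  manyPeaks         (noPeak true)                       = refl
transfer-prepend false true  (noPeak true)     (onePeak 0 false)                   = refl
transfer-prepend false true  (onePeak j false) (onePeak 0 false)                   = refl
transfer-prepend false true  (noPeak true)     (onePeak 0 true)                    = refl
transfer-prepend false true  (onePeak j false) (onePeak 0 true)                    = refl
transfer-prepend false true  (noPeak false)    (onePeak 0 h′)                      = refl
transfer-prepend false true  (onePeak j true)  (onePeak 0 h′)                      = refl
transfer-prepend false true  manyPeaks         (onePeak 0 h′)                      = refl
transfer-prepend false true  (noPeak false)    (onePeak 1 false)                   = refl
transfer-prepend false true  (noPeak true)     (onePeak 1 false)                   = refl
transfer-prepend false true  (onePeak j false) (onePeak 1 false)                   = sym (ℕₚ.+-identityʳ _)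
transfer-prepend false true  (onePeak j true)  (onePeak 1 false)                   = refl
transfer-prepend false true  manyPeaks         (onePeak 1 false)                   = refl
transfer-prepend false true  (noPeak false)    (onePeak 1 true)                    = refl
transfer-prepend false true  (noPeak true)     (onePeak 1 true)                    = refl
transfer-prepend false true  (onePeak j false) (onePeak 1 true)                    = refl
transfer-prepend false true  (onePeak j true)  (onePeak 1 true)                    = refl
transfer-prepend false true  manyPeaks         (onePeak 1 true)                    = refl
transfer-prepend false true  (noPeak true)     (onePeak 2 false)                   = refl
transfer-prepend false true  (noPeak false)    (onePeak (suc (suc m)) false)       = refl
transfer-prepend false true  (onePeak j false) (onePeak (suc (suc m)) false)       = sym (ℕₚ.+-identityʳ _)
transfer-prepend false true  (onePeak j true)  (onePeak (suc (suc m)) false)       = refl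
transfer-prepend false true  manyPeaks         (onePeak (suc (suc m)) false)       = refl
transfer-prepend false true  (noPeak false)    (onePeak (suc (suc m)) true)        = refl
transfer-prepend false true  (noPeak true)     (onePeak (suc (suc m)) true)        = sym (ℕₚ.+-identityʳ _)
transfer-prepend false true  (onePeak j false) (onePeak (suc (suc m)) true)        = sym (ℕₚ.+-identityʳ _)
transfer-prepend false true  (onePeak j true)  (onePeak (suc (suc m)) true)        = refl
transfer-prepend false true  manyPeaks         (onePeak (suc (suc m)) true)        = refl
transfer-prepend false true  (noPeak true)     (onePeak (suc (suc (suc m))) false) = refl
transfer-prepend false false (noPeak false)    (noPeak false)                      = refl
transfer-prepend false false (noPeak true)     (noPeak false)                      = refl
transfer-prepend false false (onePeak j false) (noPeak false)                      = refl
transfer-prepend false false (onePeak j true)  (noPeak false)                      = refl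
transfer-prepend false false manyPeaks         (noPeak false)                      = refl
transfer-prepend false false (noPeak false)    (noPeak true)                       = refl
transfer-prepend false false (noPeak true)     (noPeak true)                       = refl
transfer-prepend false false (onePeak j false) (noPeak true)                       = refl
transfer-prepend false false (onePeak j true)  (noPeak true)                       = refl
transfer-prepend false false manyPeaks         (noPeak true)                       = refl
transfer-prepend false false (noPeak true)     (onePeak 0 false)                   = refl
transfer-prepend false false (onePeak j false) (onePeak 0 false)                   = refl
transfer-prepend false false (onePeak j true)  (onePeak 0 false)                   = refl
transfer-prepend false false (noPeak true)     (onePeak 0 true)                    = refl
transfer-prepend false false (onePeak j false) (onePeak 0 true)                    = refl
transfer-prepend false false (onePeak j true)  (onePeak 0 true)                    = refl
transfer-prepend false false (noPeak false)    (onePeak 0 h′)                      = refl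
transfer-prepend false false manyPeaks         (onePeak 0 h′)                      = refl
transfer-prepend false false (noPeak false)    (onePeak 1 false)                   = refl
transfer-prepend false false (noPeak true)     (onePeak 1 false)                   = refl
transfer-prepend false false (noPeak false)    (onePeak 1 true)                    = refl
transfer-prepend false false (noPeak true)     (onePeak 1 true)                    = refl
transfer-prepend false false (noPeak true)     (onePeak 2 true)                    = refl
transfer-prepend false false (onePeak j false) (onePeak (suc m) false)             = refl
transfer-prepend false false (onePeak j true)  (onePeak (suc m) false)             = refl
transfer-prepend false false manyPeaks         (onePeak (suc m) false)             = refl
transfer-prepend false false (onePeak j false) (onePeak (suc m) true)              = solve (𝟙 (j ≡ᵇ m)) (𝟙 (suc j ≡ᵇ m))
  where solve : ∀ a b → 2 * a + 2 * b ≡ b + (2 * a + 0 + (b + 0))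
        solve = ℕ-Solver.solve-∀
transfer-prepend false false (onePeak j true)  (onePeak (suc m) true)              = sym (ℕₚ.+-identityʳ _)
transfer-prepend false false manyPeaks         (onePeak (suc m) true)              = refl
transfer-prepend false false (noPeak false)    (onePeak (suc (suc m)) false)       = refl
transfer-prepend false false (noPeak true)     (onePeak (suc (suc m)) false)       = refl
transfer-prepend false false (noPeak false)    (onePeak (suc (suc m)) true)        = refl
transfer-prepend false false (noPeak true)     (onePeak (suc (suc (suc m))) true)  = refl

arrivals : Bool → List Bool → PeakClass → ℕ
arrivals b s K' = sum (map (λ t → δ (classOf t) K') (stepInsertions b s))

-- The targets reachable from step words of length n by one insertion; on the other targets
-- with at most one peak, transfer does not count correctly.
Admissible : ℕ → PeakClass → Set
Admissible n (noPeak _)    = ⊤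
Admissible n (onePeak m _) = m ≤ n
Admissible n manyPeaks     = ⊥

admissible⇒atMostOnePeak : ∀ {K} → Admissible n K → AtMostOnePeak K
admissible⇒atMostOnePeak {K = noPeak h}    _ = noPeak h
admissible⇒atMostOnePeak {K = onePeak m h} _ = onePeak m h

preimages-admissible : ∀ c K' → Admissible (suc n) K' → All (Admissible n) (preimages c K')
preimages-admissible true  (noPeak false)                _         = tt ∷ []
preimages-admissible true  (noPeak true)                 _         = []
preimages-admissible false (noPeak false)                _         = []
preimages-admissible false (noPeak true)                 _         = tt ∷ tt ∷ []
preimages-admissible true  (onePeak 0 _)                 _         = []
preimages-admissible true  (onePeak 1 false)             _         = tt ∷ z≤n ∷ []
preimages-admissible true  (onePeak 1 true)              _         = []
preimages-admissible true  (onePeak (suc (suc m)) false) (s≤s m<n) = m<n ∷ []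
preimages-admissible true  (onePeak (suc (suc m)) true)  _         = []
preimages-admissible false (onePeak 0 _)                 _         = []
preimages-admissible false (onePeak (suc m) false)       _         = []
preimages-admissible false (onePeak (suc m) true)        (s≤s m≤n) = m≤n ∷ m≤n ∷ []

arrivals-∷ : ∀ b c s {K'} → AtMostOnePeak K' →
  arrivals b (c ∷ s) K' ≡ δ (prepend b (prepend (not b) (classOf s))) K' + sum (map (arrivals b s) (preimages c K'))
arrivals-∷ b c s {K'} atMostOne = cong (_+_ (δ (prepend b (prepend (not b) (classOf s))) K')) (begin
  sum (map (λ t → δ (classOf t) K') (map (c ∷_) (stepInsertions b s)))
    ≡⟨ cong sum (Listₚ.map-∘ (stepInsertions b s)) ⟨
  sum (map (λ t → δ (prepend c (classOf t)) K') (stepInsertions b s))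
    ≡⟨ cong sum (Listₚ.map-cong (λ t → δ-prepend c (classOf t) atMostOne) (stepInsertions b s)) ⟩
  sum (map (λ t → sum (map (δ (classOf t)) (preimages c K'))) (stepInsertions b s))
    ≡⟨ sum-map-swap (λ t → δ (classOf t)) (stepInsertions b s) (preimages c K') ⟩
  sum (map (arrivals b s) (preimages c K')) ∎)
  where open ≡-Reasoning

arrivals≡transfer : ∀ b s {K'} → Admissible (length s) K' → arrivals b s K' ≡ transfer b (classOf s) K'
arrivals≡transfer true  [] {noPeak false}  _ = refl
arrivals≡transfer true  [] {noPeak true}   _ = refl
arrivals≡transfer false [] {noPeak false}  _ = refl
arrivals≡transfer false [] {noPeak true}   _ = refl
arrivals≡transfer true  [] {onePeak 0 _}   _ = refl
arrivals≡transfer false [] {onePeak 0 _}   _ = refl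
arrivals≡transfer b (c ∷ s) {K'} adm = begin
  arrivals b (c ∷ s) K'
    ≡⟨ arrivals-∷ b c s (admissible⇒atMostOnePeak adm) ⟩
  δ (prepend b (prepend (not b) (classOf s))) K' + sum (map (arrivals b s) (preimages c K'))
    ≡⟨ cong (_+_ (δ (prepend b (prepend (not b) (classOf s))) K')) induction ⟩
  δ (prepend b (prepend (not b) (classOf s))) K' + sum (map (transfer b (classOf s)) (preimages c K'))
    ≡⟨ transfer-prepend b c (classOf s) (admissible⇒atMostOnePeak adm) ⟨
  transfer b (classOf (c ∷ s)) K' ∎
  where
  open ≡-Reasoning
  induction : sum (map (arrivals b s) (preimages c K')) ≡ sum (map (transfer b (classOf s)) (preimages c K'))
  induction = cong sum (Listₚ.map-cong-local (All.map (arrivals≡transfer b s) (preimages-admissible c K' adm)))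


Σclass : ℕ → (PeakClass → ℕ) → ℕ
Σclass n F = sum (map (F ∘ classOf ∘ stepWord) (signedPerms n))

count : ℕ → PeakClass → ℕ
count n K = Σclass n (λ K₀ → δ K₀ K)

Σclass-cong : ∀ n {F G} → (∀ K → F K ≡ G K) → Σclass n F ≡ Σclass n G
Σclass-cong n F≗G = cong sum (Listₚ.map-cong (F≗G ∘ classOf ∘ stepWord) (signedPerms n))

count-suc : ∀ {K'} → Admissible n K' → count (suc n) K' ≡ Σclass n (λ K → transfer true K K' + transfer false K K')
count-suc {n} {K'} adm = begin
  sum (map (λ u → δ (classOf (stepWord u)) K') (concatMap extensions (signedPerms n)))
    ≡⟨ sum-map-concatMap _ extensions (signedPerms n) ⟩
  sum (map (λ w → sum (map (λ u → δ (classOf (stepWord u)) K') (extensions w))) (signedPerms n))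
    ≡⟨ cong sum (Listₚ.map-cong-local (All.tabulate extension-arrivals)) ⟩
  Σclass n (λ K → transfer true K K' + transfer false K K') ∎
  where
  open ≡-Reasoning
  extension-arrivals : ∀ {w} → w ∈ signedPerms n →
    sum (map (λ u → δ (classOf (stepWord u)) K') (extensions w)) ≡
    transfer true (classOf (stepWord w)) K' + transfer false (classOf (stepWord w)) K'
  extension-arrivals {w} w∈ = begin
    sum (map (λ u → δ (classOf (stepWord u)) K') (extensions w))
      ≡⟨ cong sum (Listₚ.map-∘ (extensions w)) ⟩
    sum (map (λ t → δ (classOf t) K') (map stepWord (extensions w)))
      ≡⟨ cong (sum ∘ map (λ t → δ (classOf t) K')) (stepWord-extensions w∈) ⟩
    sum (map (λ t → δ (classOf t) K') (stepInsertions true (stepWord w) ++ stepInsertions false (stepWord w)))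
      ≡⟨ cong sum (Listₚ.map-++ (λ t → δ (classOf t) K') (stepInsertions true (stepWord w)) _) ⟩
    sum (map (λ t → δ (classOf t) K') (stepInsertions true (stepWord w)) ++ map (λ t → δ (classOf t) K') (stepInsertions false (stepWord w)))
      ≡⟨ sum-++ (map (λ t → δ (classOf t) K') (stepInsertions true (stepWord w))) _ ⟩
    arrivals true (stepWord w) K' + arrivals false (stepWord w) K'
      ≡⟨ cong₂ _+_ (arrivals≡transfer true (stepWord w) adm′) (arrivals≡transfer false (stepWord w) adm′) ⟩
    transfer true (classOf (stepWord w)) K' + transfer false (classOf (stepWord w)) K' ∎
    where adm′ = subst (λ k → Admissible k K') (sym (length-stepWord w)) adm

δ-classOf-outside : ∀ s {j h} → ¬ Interior s j → δ (classOf s) (onePeak j h) ≡ 0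
δ-classOf-outside s {j} {h} outside with classOf s | classifies-classOf s
... | noPeak _    | _ = refl
... | manyPeaks   | _ = refl
... | onePeak i h₀ | onePeak _ int _ =
  cong 𝟙 (trans (cong ((h₀ ≐ h) ∧_) (≢⇒≡ᵇ-false {i} {j} λ { refl → outside int })) (Boolₚ.∧-zeroʳ (h₀ ≐ h)))

count-onePeak-outside : ∀ n j h → (∀ {s} → length s ≡ n → ¬ Interior s j) → count n (onePeak j h) ≡ 0
count-onePeak-outside n j h outside =
  sum-map-zero (λ w → δ-classOf-outside (stepWord w) (outside {stepWord w} (length-stepWord w))) (signedPerms n)

count-onePeak-0 : ∀ n h → count n (onePeak 0 h) ≡ 0
count-onePeak-0 n h = count-onePeak-outside n 0 h λ { _ (() , _) }

count-onePeak-≥ : ∀ {n j} h → n ≤ j → count n (onePeak j h) ≡ 0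
count-onePeak-≥ {n} {j} h n≤j =
  count-onePeak-outside n j h λ { refl (_ , 1+j≤n) → ℕₚ.<-irrefl refl (ℕₚ.<-≤-trans 1+j≤n n≤j) }

δ-onePeak-pair : ∀ m h → δ (onePeak m h) (onePeak m false) + δ (onePeak m h) (onePeak m true) ≡ 1
δ-onePeak-pair m false rewrite ≡ᵇ-refl m = refl
δ-onePeak-pair m true  rewrite ≡ᵇ-refl m = refl

δ-onePeak-pair-≢ : ∀ K m → (∀ h → K ≢ onePeak m h) → δ K (onePeak m false) + δ K (onePeak m true) ≡ 0
δ-onePeak-pair-≢ (noPeak _)    m _ = refl
δ-onePeak-pair-≢ manyPeaks     m _ = refl
δ-onePeak-pair-≢ (onePeak j h) m K≢ rewrite ≢⇒≡ᵇ-false {j} {m} (λ { refl → K≢ h refl }) with h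
... | false = refl
... | true  = refl

peakSetIsSingleton⇔classOf≡onePeak : ∀ {n m} {v : Vec ℤ n} → 1 ≤ m → m < n → v ∈ signedPerms n →
  PeakSetIsSingleton v m ⇔ (∃[ h ] classOf (stepWord v) ≡ onePeak m h)
peakSetIsSingleton⇔classOf≡onePeak {m = m} {v} 1≤m m<n v∈ = ⇔.trans (peakSetIsSingleton⇔singlePeak v∈)
  (singlePeak⇔classOf≡onePeak (stepWord v) (1≤m , subst (m <_) (sym (length-stepWord v)) m<n))

singleton-indicator : ∀ {n m} {v : Vec ℤ n} → 1 ≤ m → m < n → v ∈ signedPerms n →
  𝟙 (does (peakSetIsSingleton? v m)) ≡ δ (classOf (stepWord v)) (onePeak m false) + δ (classOf (stepWord v)) (onePeak m true)
singleton-indicator {n} {m} {v} 1≤m m<n v∈ with peakSetIsSingleton? v m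
... | yes single with h , eq ← Equivalence.to (peakSetIsSingleton⇔classOf≡onePeak 1≤m m<n v∈) single
  rewrite eq = sym (δ-onePeak-pair m h)
... | no ¬single = sym (δ-onePeak-pair-≢ (classOf (stepWord v)) m λ h eq →
  ¬single (Equivalence.from (peakSetIsSingleton⇔classOf≡onePeak 1≤m m<n v∈) (h , eq)))

length-PhatB : ∀ {n m} → 1 ≤ m → m < n →
  length (PhatB-singleton m n) ≡ count n (onePeak m false) + count n (onePeak m true)
length-PhatB {n} {m} 1≤m m<n = begin
  length (PhatB-singleton m n)
    ≡⟨ cong length (filter-×-dec (isSignedPerm? n) (λ π → peakSetIsSingleton? π m) (words (letters n) n)) ⟩
  length (filter (λ π → peakSetIsSingleton? π m) (filter (isSignedPerm? n) (words (letters n) n)))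
    ≡⟨ ↭-length (filter-↭ (λ π → peakSetIsSingleton? π m) (filter-words↭signedPerms n)) ⟩
  length (filter (λ π → peakSetIsSingleton? π m) (signedPerms n))
    ≡⟨ length-filter≡sum (λ π → peakSetIsSingleton? π m) (signedPerms n) ⟩
  sum (map (λ π → 𝟙 (does (peakSetIsSingleton? π m))) (signedPerms n))
    ≡⟨ cong sum (Listₚ.map-cong-local (All.tabulate (singleton-indicator 1≤m m<n))) ⟩
  sum (map (λ π → δ (classOf (stepWord π)) (onePeak m false) + δ (classOf (stepWord π)) (onePeak m true)) (signedPerms n))
    ≡⟨ sum-map-+ _ _ (signedPerms n) ⟩
  count n (onePeak m false) + count n (onePeak m true) ∎
  where open ≡-Reasoning


-- The recurrences

LinComb : Set
LinComb = List (ℕ × PeakClass)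

evalδ : LinComb → PeakClass → ℕ
evalδ t K = sum (map (λ (a , K') → a * δ K K') t)

evalCount : ℕ → LinComb → ℕ
evalCount n t = sum (map (λ (a , K') → a * count n K') t)

Σclass-evalδ : ∀ n t → Σclass n (evalδ t) ≡ evalCount n t
Σclass-evalδ n []             = sum-map-zero (λ _ → refl) (signedPerms n)
Σclass-evalδ n ((a , K') ∷ t) = begin
  Σclass n (λ K → a * δ K K' + evalδ t K)       ≡⟨ sum-map-+ _ _ (signedPerms n) ⟩
  Σclass n (λ K → a * δ K K') + Σclass n (evalδ t) ≡⟨ cong₂ _+_ (sum-map-* a _ (signedPerms n)) (Σclass-evalδ n t) ⟩
  a * count n K' + evalCount n t                 ∎
  where open ≡-Reasoning

data HasStepRule : PeakClass → Set where
  noPeak  : ∀ h → HasStepRule (noPeak h)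
  onePeak : ∀ m h → HasStepRule (onePeak (suc m) h)

stepRule : PeakClass → LinComb
stepRule (noPeak false)                = (1 , noPeak false) ∷ []
stepRule (noPeak true)                 = (1 , noPeak false) ∷ (3 , noPeak true) ∷ []
stepRule (onePeak 1 false)             = (2 , noPeak false) ∷ (1 , noPeak true) ∷ (4 , onePeak 1 false) ∷ (1 , onePeak 0 false) ∷ []
stepRule (onePeak 1 true)              = (4 , onePeak 1 true) ∷ (1 , onePeak 0 false) ∷ (3 , onePeak 0 true) ∷ []
stepRule (onePeak (suc (suc m)) false) = (2 , noPeak false) ∷ (4 , onePeak (2 + m) false) ∷ (1 , onePeak (1 + m) false) ∷ []
stepRule (onePeak (suc (suc m)) true)  =
  (2 , noPeak true) ∷ (4 , onePeak (2 + m) true) ∷ (3 , onePeak (1 + m) true) ∷ (1 , onePeak (1 + m) false) ∷ []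
stepRule _                             = []

transfer-total : ∀ {K'} → HasStepRule K' → ∀ K → transfer true K K' + transfer false K K' ≡ evalδ (stepRule K') K
transfer-total (noPeak false)          (noPeak false)    = refl
transfer-total (noPeak false)          (noPeak true)     = refl
transfer-total (noPeak true)           (noPeak false)    = refl
transfer-total (noPeak true)           (noPeak true)     = refl
transfer-total (noPeak false)          (onePeak _ false) = refl
transfer-total (noPeak false)          (onePeak _ true)  = refl
transfer-total (noPeak true)           (onePeak _ false) = refl
transfer-total (noPeak true)           (onePeak _ true)  = refl
transfer-total (noPeak false)          manyPeaks         = refl
transfer-total (noPeak true)           manyPeaks         = refl
transfer-total (onePeak zero false)    (noPeak false)    = refl
transfer-total (onePeak zero false)    (noPeak true)     = refl
transfer-total (onePeak zero true)     (noPeak false)    = refl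
transfer-total (onePeak zero true)     (noPeak true)     = refl
transfer-total (onePeak (suc m) false) (noPeak false)    = refl
transfer-total (onePeak (suc m) false) (noPeak true)     = refl
transfer-total (onePeak (suc m) true)  (noPeak false)    = refl
transfer-total (onePeak (suc m) true)  (noPeak true)     = refl
transfer-total (onePeak zero false)    manyPeaks         = refl
transfer-total (onePeak zero true)     manyPeaks         = refl
transfer-total (onePeak (suc m) false) manyPeaks         = refl
transfer-total (onePeak (suc m) true)  manyPeaks         = refl
transfer-total (onePeak zero false)    (onePeak j false) with j ≡ᵇ 1 | j ≡ᵇ 0
... | false | false = refl
... | false | true  = refl
... | true  | false = refl
... | true  | true  = refl
transfer-total (onePeak zero false)    (onePeak j true)  with j ≡ᵇ 1 | j ≡ᵇ 0
... | false | false = refl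
... | false | true  = refl
... | true  | false = refl
... | true  | true  = refl
transfer-total (onePeak zero true)     (onePeak j false) with j ≡ᵇ 1 | j ≡ᵇ 0
... | false | false = refl
... | false | true  = refl
... | true  | false = refl
... | true  | true  = refl
transfer-total (onePeak zero true)     (onePeak j true)  with j ≡ᵇ 1 | j ≡ᵇ 0
... | false | false = refl
... | false | true  = refl
... | true  | false = refl
... | true  | true  = refl
transfer-total (onePeak (suc m) false) (onePeak j false) with j ≡ᵇ suc (suc m) | j ≡ᵇ suc m
... | false | false = refl
... | false | true  = refl
... | true  | false = refl
... | true  | true  = refl
transfer-total (onePeak (suc m) false) (onePeak j true)  with j ≡ᵇ suc (suc m) | j ≡ᵇ suc m
... | false | false = refl
... | false | true  = refl
... | true  | false = refl
... | true  | true  = refl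
transfer-total (onePeak (suc m) true)  (onePeak j false) with j ≡ᵇ suc (suc m) | j ≡ᵇ suc m
... | false | false = refl
... | false | true  = refl
... | true  | false = refl
... | true  | true  = refl
transfer-total (onePeak (suc m) true)  (onePeak j true)  with j ≡ᵇ suc (suc m) | j ≡ᵇ suc m
... | false | false = refl
... | false | true  = refl
... | true  | false = refl
... | true  | true  = refl

count-suc-stepRule : ∀ {n K'} → Admissible n K' → HasStepRule K' → count (suc n) K' ≡ evalCount n (stepRule K')
count-suc-stepRule {n} {K'} adm rule = begin
  count (suc n) K'                                     ≡⟨ count-suc adm ⟩
  Σclass n (λ K → transfer true K K' + transfer false K K') ≡⟨ Σclass-cong n (transfer-total rule) ⟩
  Σclass n (evalδ (stepRule K'))                       ≡⟨ Σclass-evalδ n (stepRule K') ⟩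
  evalCount n (stepRule K')                            ∎
  where open ≡-Reasoning

-- Q m n and R m n count the signed permutations of [n] with peak set {m} that start with an
-- ascent, resp. a descent; E₊ n and E₋ n do the same for the empty peak set.
E₊ E₋ E : ℕ → ℕ
E₊ n = count n (noPeak false)
E₋ n = count n (noPeak true)
E  n = E₊ n + E₋ n

Q R P : ℕ → ℕ → ℕ
Q m n = count n (onePeak m false)
R m n = count n (onePeak m true)
P m n = Q m n + R m n

E₊≡1 : ∀ n → E₊ n ≡ 1
E₊≡1 zero    = refl
E₊≡1 (suc n) = trans (count-suc-stepRule {n} _ (noPeak false)) (cong (λ e → 1 * e + 0) (E₊≡1 n))

E₋-suc : ∀ n → E₋ (suc n) ≡ 1 + 3 * E₋ n
E₋-suc n = begin
  E₋ (suc n)                    ≡⟨ count-suc-stepRule {n} _ (noPeak true) ⟩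
  1 * E₊ n + (3 * E₋ n + 0)     ≡⟨ cong₂ (λ e f → 1 * e + f) (E₊≡1 n) (ℕₚ.+-identityʳ _) ⟩
  1 + 3 * E₋ n                  ∎
  where open ≡-Reasoning

-- With Q̃ 0 = E₋ the recurrence for Q (suc m) takes the same form for all m.
Q̃ : ℕ → ℕ → ℕ
Q̃ zero    n = E₋ n
Q̃ (suc m) n = Q (suc m) n

Q-step : ∀ m n → suc m ≤ n → Q (suc m) (suc n) ≡ 2 + 4 * Q (suc m) n + Q̃ m n
Q-step zero n 1≤n
  rewrite count-suc-stepRule 1≤n (onePeak 0 false) | E₊≡1 n | count-onePeak-0 n false =
  solve (E₋ n) (Q 1 n)
  where solve : ∀ e q → 2 * 1 + (1 * e + (4 * q + (1 * 0 + 0))) ≡ 2 + 4 * q + e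
        solve = ℕ-Solver.solve-∀
Q-step (suc m) n 2+m≤n
  rewrite count-suc-stepRule 2+m≤n (onePeak (suc m) false) | E₊≡1 n =
  solve (Q (2 + m) n) (Q (1 + m) n)
  where solve : ∀ q q′ → 2 * 1 + (4 * q + (1 * q′ + 0)) ≡ 2 + 4 * q + q′
        solve = ℕ-Solver.solve-∀

R-1≡0 : ∀ n → R 1 n ≡ 0
R-1≡0 zero          = refl
R-1≡0 (suc zero)    = count-onePeak-≥ {1} true ℕₚ.≤-refl
R-1≡0 (suc (suc n)) = begin
  R 1 (2 + n)
    ≡⟨ count-suc-stepRule {suc n} (s≤s z≤n) (onePeak 0 true) ⟩
  4 * R 1 (suc n) + (1 * Q 0 (suc n) + (3 * R 0 (suc n) + 0))
    ≡⟨ cong₂ (λ r q → 4 * r + (1 * q + (3 * R 0 (suc n) + 0))) (R-1≡0 (suc n)) (count-onePeak-0 (suc n) false) ⟩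
  4 * 0 + (1 * 0 + (3 * R 0 (suc n) + 0))
    ≡⟨ cong (λ r → 3 * r + 0) (count-onePeak-0 (suc n) true) ⟩
  0 ∎
  where open ≡-Reasoning

R-step : ∀ m n → 2 + m ≤ n → R (2 + m) (suc n) ≡ 2 * E₋ n + 4 * R (2 + m) n + 3 * R (1 + m) n + Q (1 + m) n
R-step m n 2+m≤n rewrite count-suc-stepRule 2+m≤n (onePeak (suc m) true) =
  solve (E₋ n) (R (2 + m) n) (R (1 + m) n) (Q (1 + m) n)
  where solve : ∀ e r r′ q′ → 2 * e + (4 * r + (3 * r′ + (1 * q′ + 0))) ≡ 2 * e + 4 * r + 3 * r′ + q′
        solve = ℕ-Solver.solve-∀

P-step : ∀ j n → suc j ≤ n → P (suc j) (suc n) + Q̃ j n ≡ 4 * P (suc j) n + 3 * P j n + 2 * E n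
P-step zero n 1≤n
  rewrite Q-step 0 n 1≤n | R-1≡0 (suc n) | R-1≡0 n | count-onePeak-0 n false | count-onePeak-0 n true | E₊≡1 n =
  solve (E₋ n) (Q 1 n)
  where solve : ∀ e q → 2 + 4 * q + e + 0 + e ≡ 4 * (q + 0) + 3 * (0 + 0) + 2 * (1 + e)
        solve = ℕ-Solver.solve-∀
P-step (suc j) n 2+j≤n
  rewrite Q-step (suc j) n 2+j≤n | R-step j n 2+j≤n | E₊≡1 n =
  solve (E₋ n) (Q (2 + j) n) (R (2 + j) n) (Q (1 + j) n) (R (1 + j) n)
  where solve : ∀ e q r q′ r′ → 2 + 4 * q + q′ + (2 * e + 4 * r + 3 * r′ + q′) + q′ ≡ 4 * (q + r) + 3 * (q′ + r′) + 2 * (1 + e)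
        solve = ℕ-Solver.solve-∀


-- Solving the recurrences

Q-out : ∀ {j n} → n ≤ j → Q j n ≡ 0
Q-out = count-onePeak-≥ _

P-out : ∀ {j n} → n ≤ j → P j n ≡ 0
P-out n≤j rewrite count-onePeak-≥ false n≤j | count-onePeak-≥ true n≤j = refl

P-0 : ∀ n → P 0 n ≡ 0
P-0 n rewrite count-onePeak-0 n false | count-onePeak-0 n true = refl

E₋-closed : ∀ n → 2 * E₋ n + 1 ≡ 3 ^ n
E₋-closed zero    = refl
E₋-closed (suc n) rewrite E₋-suc n = trans (solve (E₋ n)) (cong (3 *_) (E₋-closed n))
  where solve : ∀ e → 2 * (1 + 3 * e) + 1 ≡ 3 * (2 * e + 1)
        solve = ℕ-Solver.solve-∀

E-closed : ∀ n → 2 * E n ≡ 3 ^ n + 1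
E-closed n rewrite E₊≡1 n = trans (solve (E₋ n)) (cong (_+ 1) (E₋-closed n))
  where solve : ∀ e → 2 * (1 + e) ≡ 2 * e + 1 + 1
        solve = ℕ-Solver.solve-∀

E-suc : ∀ n → E (suc n) + 1 ≡ 3 * E n
E-suc n rewrite E₊≡1 (suc n) | E₊≡1 n | E₋-suc n = solve (E₋ n)
  where solve : ∀ e → 1 + (1 + 3 * e) + 1 ≡ 3 * (1 + e)
        solve = ℕ-Solver.solve-∀

Pascal : ∀ n k → (suc n C suc k) ≡ (n C k) + (n C suc k)
Pascal n k = sym (nCk+nC[k+1]≡[n+1]C[k+1] n k)

-- P⊆ k n counts the signed permutations of [n] whose peak set lies in {k, k+1};
-- Q⊆ is the correction term in its recurrence (P⊆-step).
P⊆ : ℕ → ℕ → ℕ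
P⊆ j n = E n + P j n + P (suc j) n

Q⊆ : ℕ → ℕ → ℕ
Q⊆ j n = Q̃ j n + Q (suc j) n + 1

Q⊆-step-0 : ∀ n → 1 ≤ n → Q⊆ 0 (suc n) ≡ 4 * Q⊆ 0 n
Q⊆-step-0 n 1≤n rewrite E₋-suc n | Q-step 0 n 1≤n = solve (E₋ n) (Q 1 n)
  where solve : ∀ e q → 1 + 3 * e + (2 + 4 * q + e) + 1 ≡ 4 * (e + q + 1)
        solve = ℕ-Solver.solve-∀

Q⊆-step : ∀ m n → 2 + m ≤ n → Q⊆ (suc m) (suc n) ≡ 4 * Q⊆ (suc m) n + Q⊆ m n
Q⊆-step m n 2+m≤n rewrite Q-step m n (ℕₚ.<⇒≤ 2+m≤n) | Q-step (suc m) n 2+m≤n =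
  solve (Q (suc m) n) (Q (2 + m) n) (Q̃ m n)
  where solve : ∀ q q′ q̃ → 2 + 4 * q + q̃ + (2 + 4 * q′ + q) + 1 ≡ 4 * (q + q′ + 1) + (q̃ + q + 1)
        solve = ℕ-Solver.solve-∀

Q⊆-boundary : ∀ m → Q⊆ (suc m) (2 + m) ≡ 2 + Q⊆ m (suc m)
Q⊆-boundary m rewrite Q-step m (suc m) ℕₚ.≤-refl | Q-out {suc m} ℕₚ.≤-refl | Q-out {2 + m} ℕₚ.≤-refl =
  solve (Q̃ m (suc m))
  where solve : ∀ q̃ → 2 + 4 * 0 + q̃ + 0 + 1 ≡ 2 + (q̃ + 0 + 1)
        solve = ℕ-Solver.solve-∀

Q⊆-closed : ∀ r m → Q⊆ m (r + suc m) ≡ ((r + suc m) C m) * 2 * 4 ^ r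
Q⊆-closed zero    zero    = refl
Q⊆-closed zero    (suc m) = begin
  Q⊆ (suc m) (2 + m)                         ≡⟨ Q⊆-boundary m ⟩
  2 + Q⊆ m (suc m)                           ≡⟨ cong (_+_ 2) (Q⊆-closed 0 m) ⟩
  2 + (suc m C m) * 2 * 1                    ≡⟨ solve (suc m C m) ⟩
  ((suc m C m) + 1) * 2 * 1                  ≡⟨ cong (λ c → ((suc m C m) + c) * 2 * 1) (nCn≡1 (suc m)) ⟨
  ((suc m C m) + (suc m C suc m)) * 2 * 1    ≡⟨ cong (λ c → c * 2 * 1) (Pascal (suc m) m) ⟨
  ((2 + m) C suc m) * 2 * 1                  ∎
  where
  open ≡-Reasoning
  solve : ∀ c → 2 + c * 2 * 1 ≡ (c + 1) * 2 * 1
  solve = ℕ-Solver.solve-∀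
Q⊆-closed (suc r) zero = begin
  Q⊆ 0 (suc (r + 1))                     ≡⟨ Q⊆-step-0 (r + 1) (ℕₚ.m≤n+m 1 r) ⟩
  4 * Q⊆ 0 (r + 1)                       ≡⟨ cong (4 *_) (Q⊆-closed r 0) ⟩
  4 * (1 * 2 * 4 ^ r)                    ≡⟨ solve (4 ^ r) ⟩
  1 * 2 * 4 ^ suc r                      ∎
  where
  open ≡-Reasoning
  solve : ∀ x → 4 * (1 * 2 * x) ≡ 1 * 2 * (4 * x)
  solve = ℕ-Solver.solve-∀
Q⊆-closed (suc r) (suc m) = begin
  Q⊆ (suc m) (suc N)                                         ≡⟨ Q⊆-step m N (ℕₚ.m≤n+m _ r) ⟩
  4 * Q⊆ (suc m) N + Q⊆ m N                                  ≡⟨ cong₂ (λ q q′ → 4 * q + q′) (Q⊆-closed r (suc m)) Q⊆-m-N ⟩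
  4 * ((N C suc m) * 2 * 4 ^ r) + (N C m) * 2 * 4 ^ suc r    ≡⟨ solve (N C m) (N C suc m) (4 ^ r) ⟩
  ((N C m) + (N C suc m)) * 2 * 4 ^ suc r                    ≡⟨ cong (λ c → c * 2 * 4 ^ suc r) (Pascal N m) ⟨
  (suc N C suc m) * 2 * 4 ^ suc r                            ∎
  where
  open ≡-Reasoning
  N = r + suc (suc m)
  Q⊆-m-N : Q⊆ m N ≡ (N C m) * 2 * 4 ^ suc r
  Q⊆-m-N = subst (λ k → Q⊆ m k ≡ (k C m) * 2 * 4 ^ suc r) (sym (ℕₚ.+-suc r (suc m))) (Q⊆-closed (suc r) m)
  solve : ∀ c c′ x → 4 * (c′ * 2 * x) + c * 2 * (4 * x) ≡ (c + c′) * 2 * (4 * x)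
  solve = ℕ-Solver.solve-∀

P⊆-0≡Q⊆-0 : ∀ n → P⊆ 0 n ≡ Q⊆ 0 n
P⊆-0≡Q⊆-0 n rewrite E₊≡1 n | P-0 n | R-1≡0 n = solve (E₋ n) (Q 1 n)
  where solve : ∀ e q → 1 + e + 0 + (q + 0) ≡ e + q + 1
        solve = ℕ-Solver.solve-∀

P⊆-step : ∀ k n → 2 + k ≤ n → P⊆ (suc k) (suc n) + Q⊆ k n ≡ 4 * P⊆ (suc k) n + 3 * P⊆ k n
P⊆-step k n 2+k≤n = begin
  E (suc n) + P (suc k) (suc n) + P (2 + k) (suc n) + (Q̃ k n + Q̃ (suc k) n + 1)
    ≡⟨ solve (E (suc n)) (P (suc k) (suc n)) (P (2 + k) (suc n)) (Q̃ k n) (Q̃ (suc k) n) ⟩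
  (E (suc n) + 1) + (P (suc k) (suc n) + Q̃ k n) + (P (2 + k) (suc n) + Q̃ (suc k) n)
    ≡⟨ cong₂ (λ e p → e + p + (P (2 + k) (suc n) + Q̃ (suc k) n)) (E-suc n) (P-step k n (ℕₚ.<⇒≤ 2+k≤n)) ⟩
  3 * E n + (4 * P (suc k) n + 3 * P k n + 2 * E n) + (P (2 + k) (suc n) + Q̃ (suc k) n)
    ≡⟨ cong (_+_ (3 * E n + (4 * P (suc k) n + 3 * P k n + 2 * E n))) (P-step (suc k) n 2+k≤n) ⟩
  3 * E n + (4 * P (suc k) n + 3 * P k n + 2 * E n) + (4 * P (2 + k) n + 3 * P (suc k) n + 2 * E n)
    ≡⟨ solve′ (E n) (P k n) (P (suc k) n) (P (2 + k) n) ⟩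
  4 * P⊆ (suc k) n + 3 * P⊆ k n ∎
  where
  open ≡-Reasoning
  solve : ∀ e p p′ q̃ q̃′ → e + p + p′ + (q̃ + q̃′ + 1) ≡ (e + 1) + (p + q̃) + (p′ + q̃′)
  solve = ℕ-Solver.solve-∀
  solve′ : ∀ e p p′ p″ → 3 * e + (4 * p′ + 3 * p + 2 * e) + (4 * p″ + 3 * p′ + 2 * e) ≡ 4 * (e + p′ + p″) + 3 * (e + p + p′)
  solve′ = ℕ-Solver.solve-∀

P⊆-boundary : ∀ k → P⊆ (suc k) (2 + k) + Q⊆ k (suc k) ≡ 2 * E (suc k) + 3 * P⊆ k (suc k)
P⊆-boundary k = begin
  E (2 + k) + P (suc k) (2 + k) + P (2 + k) (2 + k) + (Q̃ k (suc k) + Q (suc k) (suc k) + 1)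
    ≡⟨ cong₂ (λ p q → E (2 + k) + P (suc k) (2 + k) + p + (Q̃ k (suc k) + q + 1))
             (P-out {2 + k} ℕₚ.≤-refl) (Q-out {suc k} ℕₚ.≤-refl) ⟩
  E (2 + k) + P (suc k) (2 + k) + 0 + (Q̃ k (suc k) + 0 + 1)
    ≡⟨ solve (E (2 + k)) (P (suc k) (2 + k)) (Q̃ k (suc k)) ⟩
  (E (2 + k) + 1) + (P (suc k) (2 + k) + Q̃ k (suc k))
    ≡⟨ cong₂ _+_ (E-suc (suc k)) (P-step k (suc k) ℕₚ.≤-refl) ⟩
  3 * E (suc k) + (4 * P (suc k) (suc k) + 3 * P k (suc k) + 2 * E (suc k))
    ≡⟨ cong (λ p → 3 * E (suc k) + (4 * p + 3 * P k (suc k) + 2 * E (suc k))) (P-out {suc k} ℕₚ.≤-refl) ⟩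
  3 * E (suc k) + (4 * 0 + 3 * P k (suc k) + 2 * E (suc k))
    ≡⟨ solve′ (E (suc k)) (P k (suc k)) ⟩
  2 * E (suc k) + 3 * (E (suc k) + P k (suc k) + 0)
    ≡⟨ cong (λ p → 2 * E (suc k) + 3 * (E (suc k) + P k (suc k) + p)) (P-out {suc k} ℕₚ.≤-refl) ⟨
  2 * E (suc k) + 3 * P⊆ k (suc k) ∎
  where
  open ≡-Reasoning
  solve : ∀ e p q̃ → e + p + 0 + (q̃ + 0 + 1) ≡ (e + 1) + (p + q̃)
  solve = ℕ-Solver.solve-∀
  solve′ : ∀ e p → 3 * e + (4 * 0 + 3 * p + 2 * e) ≡ 2 * e + 3 * (e + p + 0)
  solve′ = ℕ-Solver.solve-∀

-- The inductive cases obtain P⊆ from P⊆-step and P⊆-boundary by cancelling the correction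
-- term Q⊆, whose closed form is already known.
P⊆-closed : ∀ r k → P⊆ k (r + suc k) ≡ ((r + suc k) C k) * (3 ^ k + 1) * 4 ^ r
P⊆-closed r zero = trans (P⊆-0≡Q⊆-0 (r + 1)) (Q⊆-closed r 0)
P⊆-closed zero (suc k) = ℕₚ.+-cancelʳ-≡ u _ _ (begin
  P⊆ (suc k) (2 + k) + u                           ≡⟨ cong (_+_ (P⊆ (suc k) (2 + k))) (Q⊆-closed 0 k) ⟨
  P⊆ (suc k) (2 + k) + Q⊆ k (suc k)                ≡⟨ P⊆-boundary k ⟩
  2 * E (suc k) + 3 * P⊆ k (suc k)                 ≡⟨ cong₂ (λ e p → e + 3 * p) (E-closed (suc k)) (P⊆-closed 0 k) ⟩
  3 ^ suc k + 1 + 3 * (c * (3 ^ k + 1) * 1)        ≡⟨ solve c (3 ^ k) ⟩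
  (c + 1) * (3 ^ suc k + 1) * 1 + u                ≡⟨ cong (λ c′ → (c + c′) * (3 ^ suc k + 1) * 1 + u) (nCn≡1 (suc k)) ⟨
  (c + (suc k C suc k)) * (3 ^ suc k + 1) * 1 + u  ≡⟨ cong (λ c′ → c′ * (3 ^ suc k + 1) * 1 + u) (Pascal (suc k) k) ⟨
  ((2 + k) C suc k) * (3 ^ suc k + 1) * 1 + u      ∎)
  where
  open ≡-Reasoning
  c = suc k C k
  u = c * 2 * 1
  solve : ∀ c x → 3 * x + 1 + 3 * (c * (x + 1) * 1) ≡ (c + 1) * (3 * x + 1) * 1 + c * 2 * 1
  solve = ℕ-Solver.solve-∀
P⊆-closed (suc r) (suc k) = ℕₚ.+-cancelʳ-≡ u _ _ (begin
  P⊆ (suc k) (suc N) + u                   ≡⟨ cong (_+_ (P⊆ (suc k) (suc N))) Q⊆-k-N ⟨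
  P⊆ (suc k) (suc N) + Q⊆ k N              ≡⟨ P⊆-step k N (ℕₚ.m≤n+m _ r) ⟩
  4 * P⊆ (suc k) N + 3 * P⊆ k N            ≡⟨ cong₂ (λ p p′ → 4 * p + 3 * p′) (P⊆-closed r (suc k)) P⊆-k-N ⟩
  4 * ((N C suc k) * (3 ^ suc k + 1) * 4 ^ r) + 3 * ((N C k) * (3 ^ k + 1) * 4 ^ suc r)
                                           ≡⟨ solve (N C k) (N C suc k) (3 ^ k) (4 ^ r) ⟩
  ((N C k) + (N C suc k)) * (3 ^ suc k + 1) * 4 ^ suc r + u
                                           ≡⟨ cong (λ c → c * (3 ^ suc k + 1) * 4 ^ suc r + u) (Pascal N k) ⟨
  (suc N C suc k) * (3 ^ suc k + 1) * 4 ^ suc r + u ∎)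
  where
  open ≡-Reasoning
  N = r + suc (suc k)
  N≡ : suc r + suc k ≡ N
  N≡ = sym (ℕₚ.+-suc r (suc k))
  u = (N C k) * 2 * 4 ^ suc r
  Q⊆-k-N : Q⊆ k N ≡ u
  Q⊆-k-N = subst (λ n → Q⊆ k n ≡ (n C k) * 2 * 4 ^ suc r) N≡ (Q⊆-closed (suc r) k)
  P⊆-k-N : P⊆ k N ≡ (N C k) * (3 ^ k + 1) * 4 ^ suc r
  P⊆-k-N = subst (λ n → P⊆ k n ≡ (n C k) * (3 ^ k + 1) * 4 ^ suc r) N≡ (P⊆-closed (suc r) k)
  solve : ∀ c c′ x y → 4 * (c′ * (3 * x + 1) * y) + 3 * (c * (x + 1) * (4 * y)) ≡
                       (c + c′) * (3 * x + 1) * (4 * y) + c * 2 * (4 * y)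
  solve = ℕ-Solver.solve-∀


-- The alternating sum

term : ℕ → ℕ → ℕ → ℤ
term n m i = + ((n C (m ∸ i)) ℕ.* (3 ℕ.^ (m ∸ i) ℕ.+ 1) ℕ.* 4 ℕ.^ i) ℤ.* (- (+ 1)) ℤ.^ (i ℕ.+ 1)

alternatingSum : ℕ → ℕ → ℤ
alternatingSum n m = sumℤ (map (term n m) (range 1 m))

term-suc : ∀ n m i → term n (suc m) (suc (suc i)) ≡ - (+ 4) ℤ.* term n m (suc i)
term-suc n m i = begin
  + (c ℕ.* (4 ℕ.* y)) ℤ.* (- (+ 1) ℤ.* s)
    ≡⟨ cong (ℤ._* (- (+ 1) ℤ.* s)) (trans (ℤₚ.pos-* c (4 ℕ.* y)) (cong (+ c ℤ.*_) (ℤₚ.pos-* 4 y))) ⟩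
  + c ℤ.* (+ 4 ℤ.* + y) ℤ.* (- (+ 1) ℤ.* s)
    ≡⟨ solve (+ c) (+ y) s ⟩
  - (+ 4) ℤ.* (+ c ℤ.* + y ℤ.* s)
    ≡⟨ cong (λ k → - (+ 4) ℤ.* (k ℤ.* s)) (ℤₚ.pos-* c y) ⟨
  - (+ 4) ℤ.* term n m (suc i) ∎
  where
  open ≡-Reasoning
  c = (n C (m ∸ suc i)) ℕ.* (3 ℕ.^ (m ∸ suc i) ℕ.+ 1)
  y = 4 ℕ.^ suc i
  s = (- (+ 1)) ℤ.^ (suc i ℕ.+ 1)
  solve : ∀ c y s → c ℤ.* (+ 4 ℤ.* y) ℤ.* (- (+ 1) ℤ.* s) ≡ - (+ 4) ℤ.* (c ℤ.* y ℤ.* s)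
  solve = ℤ-Solver.solve-∀

alternatingSum-suc : ∀ n m →
  alternatingSum n (suc m) ≡ + ((n C m) ℕ.* (3 ℕ.^ m ℕ.+ 1) ℕ.* 4) ℤ.+ - (+ 4) ℤ.* alternatingSum n m
alternatingSum-suc n m = begin
  sumℤ (map (term n (suc m)) (range 1 (suc m)))
    ≡⟨ sumℤ-range-suc (term n (suc m)) m ⟩
  term n (suc m) 1 ℤ.+ sumℤ (map (term n (suc m) ∘ suc) (range 1 m))
    ≡⟨ cong₂ ℤ._+_ term-1 (sumℤ-range-cong (term-suc n m) m) ⟩
  + ((n C m) ℕ.* (3 ℕ.^ m ℕ.+ 1) ℕ.* 4) ℤ.+ sumℤ (map (λ i → - (+ 4) ℤ.* term n m i) (range 1 m))
    ≡⟨ cong (ℤ._+_ (+ ((n C m) ℕ.* (3 ℕ.^ m ℕ.+ 1) ℕ.* 4))) (sumℤ-map-* (- (+ 4)) (term n m) (range 1 m)) ⟩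
  + ((n C m) ℕ.* (3 ℕ.^ m ℕ.+ 1) ℕ.* 4) ℤ.+ - (+ 4) ℤ.* alternatingSum n m ∎
  where
  open ≡-Reasoning
  term-1 : term n (suc m) 1 ≡ + ((n C m) ℕ.* (3 ℕ.^ m ℕ.+ 1) ℕ.* 4)
  term-1 = trans (ℤₚ.*-identityʳ _) (cong (λ k → + ((n C m) ℕ.* (3 ℕ.^ m ℕ.+ 1) ℕ.* k)) (ℕₚ.*-identityʳ 4))

[2+m]%2≡m%2 : ∀ m → (2 ℕ.+ m) % 2 ≡ m % 2
[2+m]%2≡m%2 m = trans (cong (_% 2) (ℕₚ.+-comm 2 m)) ([m+n]%n≡m%n m 2)

[1+m]%2≡1-m%2 : ∀ m → + (suc m % 2) ≡ + 1 ℤ.- + (m % 2)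
[1+m]%2≡1-m%2 zero          = refl
[1+m]%2≡1-m%2 (suc zero)    = refl
[1+m]%2≡1-m%2 (suc (suc m)) rewrite [2+m]%2≡m%2 (suc m) | [2+m]%2≡m%2 m = [1+m]%2≡1-m%2 m

alternatingSum-closed : ∀ {n} m r → n ≡ r ℕ.+ suc m →
  + (4 ℕ.^ r) ℤ.* alternatingSum n m ≡ + P m n ℤ.+ + (m % 2) ℤ.* + E n
alternatingSum-closed {n} zero r _ = trans (ℤₚ.*-zeroʳ (+ (4 ℕ.^ r))) (cong (λ p → + p ℤ.+ + 0) (sym (P-0 n)))
alternatingSum-closed {n} (suc m) r n≡ = begin
  + 4^r ℤ.* alternatingSum n (suc m)
    ≡⟨ cong (+ 4^r ℤ.*_) (alternatingSum-suc n m) ⟩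
  + 4^r ℤ.* (+ c ℤ.+ - (+ 4) ℤ.* alternatingSum n m)
    ≡⟨ solve (+ 4^r) (+ c) (alternatingSum n m) ⟩
  + 4^r ℤ.* + c ℤ.- (+ 4 ℤ.* + 4^r) ℤ.* alternatingSum n m
    ≡⟨ cong₂ (λ t f → t ℤ.- f ℤ.* alternatingSum n m) (trans (sym (ℤₚ.pos-* 4^r c)) (cong +_ 4^r*c≡P⊆)) (sym (ℤₚ.pos-* 4 4^r)) ⟩
  + P⊆ m n ℤ.- + (4 ℕ.^ suc r) ℤ.* alternatingSum n m
    ≡⟨ cong (ℤ._-_ (+ P⊆ m n)) (alternatingSum-closed m (suc r) (trans n≡ (ℕₚ.+-suc r (suc m)))) ⟩
  + P⊆ m n ℤ.- (+ P m n ℤ.+ + (m % 2) ℤ.* + E n)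
    ≡⟨ cong (ℤ._- (+ P m n ℤ.+ + (m % 2) ℤ.* + E n)) +-P⊆ ⟩
  + E n ℤ.+ + P m n ℤ.+ + P (suc m) n ℤ.- (+ P m n ℤ.+ + (m % 2) ℤ.* + E n)
    ≡⟨ solve′ (+ E n) (+ P m n) (+ P (suc m) n) (+ (m % 2)) ⟩
  + P (suc m) n ℤ.+ (+ 1 ℤ.- + (m % 2)) ℤ.* + E n
    ≡⟨ cong (λ k → + P (suc m) n ℤ.+ k ℤ.* + E n) ([1+m]%2≡1-m%2 m) ⟨
  + P (suc m) n ℤ.+ + (suc m % 2) ℤ.* + E n ∎
  where
  open ≡-Reasoning
  4^r = 4 ℕ.^ r
  c = (n C m) ℕ.* (3 ℕ.^ m ℕ.+ 1) ℕ.* 4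
  P⊆≡ : P⊆ m n ≡ (n C m) ℕ.* (3 ℕ.^ m ℕ.+ 1) ℕ.* 4 ℕ.^ suc r
  P⊆≡ = subst (λ k → P⊆ m k ≡ (k C m) ℕ.* (3 ℕ.^ m ℕ.+ 1) ℕ.* 4 ℕ.^ suc r)
             (sym (trans n≡ (ℕₚ.+-suc r (suc m)))) (P⊆-closed (suc r) m)
  +-P⊆ : + P⊆ m n ≡ + E n ℤ.+ + P m n ℤ.+ + P (suc m) n
  +-P⊆ = trans (ℤₚ.pos-+ (E n ℕ.+ P m n) _) (cong (ℤ._+ + P (suc m) n) (ℤₚ.pos-+ (E n) _))
  4^r*c≡P⊆ : 4^r ℕ.* c ≡ P⊆ m n
  4^r*c≡P⊆ = trans (solveℕ 4^r ((n C m) ℕ.* (3 ℕ.^ m ℕ.+ 1))) (sym P⊆≡)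
    where solveℕ : ∀ y a → y ℕ.* (a ℕ.* 4) ≡ a ℕ.* (4 ℕ.* y)
          solveℕ = ℕ-Solver.solve-∀
  solve : ∀ y c a → y ℤ.* (c ℤ.+ - (+ 4) ℤ.* a) ≡ y ℤ.* c ℤ.- (+ 4 ℤ.* y) ℤ.* a
  solve = ℤ-Solver.solve-∀
  solve′ : ∀ e p p′ q → e ℤ.+ p ℤ.+ p′ ℤ.- (p ℤ.+ q ℤ.* e) ≡ p′ ℤ.+ (+ 1 ℤ.- q) ℤ.* e
  solve′ = ℤ-Solver.solve-∀

[3^n+1]/2≡E : ∀ n → (3 ℕ.^ n ℕ.+ 1) / 2 ≡ E n
[3^n+1]/2≡E n = trans (cong (_/ 2) (trans (sym (E-closed n)) (ℕₚ.*-comm 2 (E n)))) (m*n/n≡m (E n) 2)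

proposition3p7 : (n m : ℕ) → 1 ≤ m → m < n →
    + length (PhatB-singleton m n) ≡
      (+ (4 ℕ.^ (n ∸ m ∸ 1))) ℤ.* sumℤ (map (λ i → + ((n C (m ∸ i)) ℕ.* (3 ℕ.^ (m ∸ i) ℕ.+ 1) ℕ.* 4 ℕ.^ i) ℤ.* (- (+ 1)) ℤ.^ (i ℕ.+ 1)) (range 1 m))
      ℤ.- (+ (m % 2)) ℤ.* (+ ((3 ℕ.^ n ℕ.+ 1) / 2))
proposition3p7 n m 1≤m m<n = begin
  + length (PhatB-singleton m n)
    ≡⟨ cong +_ (length-PhatB 1≤m m<n) ⟩
  + P m n
    ≡⟨ solve (+ P m n) (+ (m % 2) ℤ.* + E n) ⟩
  + P m n ℤ.+ + (m % 2) ℤ.* + E n ℤ.- + (m % 2) ℤ.* + E n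
    ≡⟨ cong₂ ℤ._-_ (alternatingSum-closed m (n ∸ m ∸ 1) n≡) (cong (λ e → + (m % 2) ℤ.* + e) ([3^n+1]/2≡E n)) ⟨
  + (4 ℕ.^ (n ∸ m ∸ 1)) ℤ.* alternatingSum n m ℤ.- + (m % 2) ℤ.* + ((3 ℕ.^ n ℕ.+ 1) / 2) ∎
  where
  open ≡-Reasoning
  n≡ : n ≡ n ∸ m ∸ 1 ℕ.+ suc m
  n≡ = trans (sym (ℕₚ.m∸n+n≡m m<n)) (cong (ℕ._+ suc m) (trans (cong (n ∸_) (ℕₚ.+-comm 1 m)) (sym (ℕₚ.∸-+-assoc n m 1))))
  solve : ∀ p x → p ≡ p ℤ.+ x ℤ.- x
  solve = ℤ-Solver.solve-∀
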